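{- For integers $\ell,m,n$ with $0\leq n\leq\ell$, \[ \sum_{k=0}^n q^{(k-n)(2k+\ell+2m-n)} {n \brack k}{\ell-k \brack k+\ell+m-n} =\sum_{k=0}^n q^{k(2k-\ell-2m-n)} {n \brack k}{\ell-k \brack k-m} \] and \[ \sum_{k=0}^n q^{(k-n)(2k+\ell+2m-n+1)} {n \brack k}{\ell-k \brack k+\ell+m-n} =q^{ -m-n} \sum_{k=0}^n q^{k(2k-\ell-2m-n+1)} {n \brack k}{\ell-k \brack k-m} +\big(1-q^{\ell-n}\big)\sum_{k=0}^n q^{k(2k-\ell-2m-n-1)} {n \brack k}{\ell-k-1 \brack k-m-1}. \]
   Context: For $n,m\in\mathbb{Z}$, the $q$-binomial coefficient is ${n\brack m}=\frac{(q;q)_n}{(q;q)_m(q;q)_{n-m}}$ if $0\leq m\leq n$ and $0$ otherwise, where $(q;q)_n=\prod_{i=1}^n(1-q^i)$. The identities are identities of Laurent polynomials in $q$. -}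

module Defs where

open import Data.Nat as ℕ using (ℕ; zero; suc)
open import Data.Integer as ℤ using (ℤ; +_; -[1+_]; _⊓_; ∣_∣; _≤_)
open import Data.List using (List; []; _∷_; map; foldr; upTo)
open import Relation.Binary.PropositionalEquality using (_≡_)

-- Polynomials in q with integer coefficients: coefficient lists,
-- head = coefficient of q^0.

Poly : Set
Poly = List ℤ

addP : Poly → Poly → Poly
addP [] p = p
addP (a ∷ p) [] = a ∷ p
addP (a ∷ p) (b ∷ r) = (a ℤ.+ b) ∷ addP p r

scaleP : ℤ → Poly → Poly
scaleP c p = map (c ℤ.*_) p

mulP : Poly → Poly → Poly
mulP [] r = []
mulP (a ∷ p) r = addP (scaleP a r) (+ 0 ∷ mulP p r)

shiftP : ℕ → Poly → Poly
shiftP zero p = p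
shiftP (suc k) p = + 0 ∷ shiftP k p

coeffP : Poly → ℕ → ℤ
coeffP [] _ = + 0
coeffP (a ∷ p) zero = a
coeffP (a ∷ p) (suc i) = coeffP p i

-- Laurent polynomials in q: the element q^low * poly.

record Laurent : Set where
  constructor laurent
  field
    low  : ℤ
    poly : Poly
open Laurent public

coeff : Laurent → ℤ → ℤ
coeff (laurent s p) e with e ℤ.- s
... | + i = coeffP p i
... | -[1+ _ ] = + 0

infix 4 _≈L_
_≈L_ : Laurent → Laurent → Set
a ≈L b = ∀ e → coeff a e ≡ coeff b e

infixl 6 _+L_
_+L_ : Laurent → Laurent → Laurent
laurent s₁ p₁ +L laurent s₂ p₂ =
  laurent (s₁ ⊓ s₂)
          (addP (shiftP ∣ s₁ ℤ.- (s₁ ⊓ s₂) ∣ p₁) (shiftP ∣ s₂ ℤ.- (s₁ ⊓ s₂) ∣ p₂))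

infixl 7 _*L_
_*L_ : Laurent → Laurent → Laurent
laurent s₁ p₁ *L laurent s₂ p₂ = laurent (s₁ ℤ.+ s₂) (mulP p₁ p₂)

0L : Laurent
0L = laurent (+ 0) []

constL : ℤ → Laurent
constL c = laurent (+ 0) (c ∷ [])

qpow : ℤ → Laurent
qpow e = laurent e (+ 1 ∷ [])

sumL : ℕ → (ℕ → Laurent) → Laurent
sumL n f = foldr (λ k acc → f k +L acc) 0L (upTo (suc n))

-- For naturals, via the q-Pascal recursion
--   [n+1, k+1] = [n, k] + q^(k+1) [n, k+1],  [n,0] = 1,  [0,k+1] = 0,
-- which yields the polynomial (q;q)_n / ((q;q)_k (q;q)_(n-k)) for
-- 0 ≤ k ≤ n and 0 for k > n.

qbinN : ℕ → ℕ → Poly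
qbinN n zero = + 1 ∷ []
qbinN zero (suc k) = []
qbinN (suc n) (suc k) = addP (qbinN n k) (shiftP (suc k) (qbinN n (suc k)))

-- For integers n, m: zero unless 0 ≤ m ≤ n.
qbin : ℤ → ℤ → Laurent
qbin (+ n) (+ m) = laurent (+ 0) (qbinN n m)
qbin (+ n) -[1+ _ ] = 0L
qbin -[1+ _ ] _ = 0L

{-# OPTIONS --safe #-}
-- Both identities are proved in ℤ[q, q⁻¹] by induction from the two Pascal rules for q-binomials.
-- For the first, Pascal's rule on [n, k] gives the left side L the recurrence
--   L(ℓ+1, n+1, m) = L(ℓ, n, m+1) + q^-(ℓ+2m) L(ℓ+1, n, m-1);
-- the right side R obeys a different recurrence in n, from which a second induction shows that R
-- satisfies the recurrence of L as well, and at n = 0 both sides equal [ℓ, ℓ+m] = [ℓ, -m].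
-- For the second identity with n < ℓ, the other Pascal rule applied to the second q-binomial
-- expresses all sums through those of the first identity for ℓ-1 and m, m+1.  For n = ℓ the
-- correction term vanishes and the symmetry [n, k][n-k, j] = [n, j][n-j, k] of q-trinomial
-- coefficients matches the two sums term by term under the shift k ↦ k+m.
module Submission where

open import Defs
open import Algebra.Bundles using (Semiring; CommutativeRing)
open import Data.Nat as ℕ using (ℕ; zero; suc; _≤_; _<_; z≤n; s≤s)
import Data.Nat.Properties as ℕₚ
open import Data.Sum using (_⊎_; inj₁; inj₂)
open import Function using (_∘_; id)
import Relation.Binary.PropositionalEquality as ≡

module RangeSum {c ℓ} (R : Semiring c ℓ) where

  open Semiring R
  open import Relation.Binary.Reasoning.Setoid setoid
  open import Algebra.Properties.CommutativeSemigroup +-commutativeSemigroup using (interchange)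

  Σ< : ℕ → (ℕ → Carrier) → Carrier
  Σ< zero    f = 0#
  Σ< (suc n) f = f 0 + Σ< n (f ∘ suc)

  Σ<-cong : ∀ n {f g} → (∀ k → k < n → f k ≈ g k) → Σ< n f ≈ Σ< n g
  Σ<-cong zero    f≈g = refl
  Σ<-cong (suc n) f≈g = +-cong (f≈g 0 (s≤s z≤n)) (Σ<-cong n (λ k k<n → f≈g (suc k) (s≤s k<n)))

  Σ<-zero : ∀ n f → (∀ k → k < n → f k ≈ 0#) → Σ< n f ≈ 0#
  Σ<-zero n f f≈0 = trans (Σ<-cong n f≈0) (Σ<-0# n)
    where
    Σ<-0# : ∀ n → Σ< n (λ _ → 0#) ≈ 0#
    Σ<-0# zero    = refl
    Σ<-0# (suc n) = trans (+-congˡ (Σ<-0# n)) (+-identityˡ 0#)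

  Σ<-+ : ∀ n f g → Σ< n (λ k → f k + g k) ≈ Σ< n f + Σ< n g
  Σ<-+ zero    f g = sym (+-identityˡ 0#)
  Σ<-+ (suc n) f g = trans (+-congˡ (Σ<-+ n (f ∘ suc) (g ∘ suc))) (interchange (f 0) (g 0) _ _)

  Σ<-*ˡ : ∀ n c f → Σ< n (λ k → c * f k) ≈ c * Σ< n f
  Σ<-*ˡ zero    c f = sym (zeroʳ c)
  Σ<-*ˡ (suc n) c f = trans (+-congˡ (Σ<-*ˡ n c (f ∘ suc))) (sym (distribˡ c (f 0) _))

  Σ<-split : ∀ m n f → Σ< (m ℕ.+ n) f ≈ Σ< m f + Σ< n (λ k → f (m ℕ.+ k))
  Σ<-split zero    n f = sym (+-identityˡ _)
  Σ<-split (suc m) n f = trans (+-congˡ (Σ<-split m n (f ∘ suc))) (sym (+-assoc (f 0) _ _))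

  Σ<-last : ∀ n f → Σ< (suc n) f ≈ Σ< n f + f n
  Σ<-last n f = begin
    Σ< (suc n) f               ≡⟨ ≡.cong (λ m → Σ< m f) (ℕₚ.+-comm 1 n) ⟩
    Σ< (n ℕ.+ 1) f             ≈⟨ Σ<-split n 1 f ⟩
    Σ< n f + (f (n ℕ.+ 0) + 0#) ≈⟨ +-congˡ (+-identityʳ _) ⟩
    Σ< n f + f (n ℕ.+ 0)       ≡⟨ ≡.cong (λ m → Σ< n f + f m) (ℕₚ.+-identityʳ n) ⟩
    Σ< n f + f n               ∎

  delayed : (ℕ → Carrier) → ℕ → Carrier
  delayed f zero    = 0#
  delayed f (suc k) = f k

  Σ<-delayed-+ : ∀ n f g → g n ≈ 0# → Σ< (suc n) (λ k → delayed f k + g k) ≈ Σ< n f + Σ< n g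
  Σ<-delayed-+ n f g gn≈0 = begin
    Σ< (suc n) (λ k → delayed f k + g k)        ≈⟨ Σ<-+ (suc n) (delayed f) g ⟩
    (0# + Σ< n f) + Σ< (suc n) g                ≈⟨ +-cong (+-identityˡ _) (Σ<-last n g) ⟩
    Σ< n f + (Σ< n g + g n)                     ≈⟨ +-congˡ (trans (+-congˡ gn≈0) (+-identityʳ _)) ⟩
    Σ< n f + Σ< n g                             ∎

  Σ<-shift : ∀ n d f g →
             (∀ k → k ℕ.+ d < n → f k ≈ g (d ℕ.+ k)) →
             (∀ k → k < n → n ≤ k ℕ.+ d → f k ≈ 0#) →
             (∀ i → i < n → i < d → g i ≈ 0#) →
             Σ< n f ≈ Σ< n g
  Σ<-shift n d f g f≈g f≈0 g≈0 with ℕₚ.≤-total d n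
  ... | inj₂ n≤d = trans (Σ<-zero n f (λ k k<n → f≈0 k k<n (ℕₚ.≤-trans n≤d (ℕₚ.m≤n+m d k))))
                         (sym (Σ<-zero n g (λ i i<n → g≈0 i i<n (ℕₚ.<-≤-trans i<n n≤d))))
  ... | inj₁ d≤n = begin
    Σ< n f                                    ≡⟨ ≡.cong (λ m → Σ< m f) n≡n′+d ⟩
    Σ< (n′ ℕ.+ d) f                           ≈⟨ Σ<-split n′ d f ⟩
    Σ< n′ f + Σ< d (λ k → f (n′ ℕ.+ k))       ≈⟨ +-congˡ (Σ<-zero d _ λ k k<d → f≈0 (n′ ℕ.+ k) (tail< k<d) (tail≥ k)) ⟩
    Σ< n′ f + 0#                              ≈⟨ +-identityʳ _ ⟩
    Σ< n′ f                                   ≈⟨ Σ<-cong n′ (λ k k<n′ → f≈g k (head< k<n′)) ⟩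
    Σ< n′ (λ k → g (d ℕ.+ k))                 ≈⟨ +-identityˡ _ ⟨
    0# + Σ< n′ (λ k → g (d ℕ.+ k))            ≈⟨ +-congʳ (Σ<-zero d g λ i i<d → g≈0 i (ℕₚ.<-≤-trans i<d d≤n) i<d) ⟨
    Σ< d g + Σ< n′ (λ k → g (d ℕ.+ k))        ≈⟨ Σ<-split d n′ g ⟨
    Σ< (d ℕ.+ n′) g                           ≡⟨ ≡.cong (λ m → Σ< m g) (ℕₚ.m+[n∸m]≡n d≤n) ⟩
    Σ< n g                                    ∎
    where
    n′ = n ℕ.∸ d
    n≡n′+d : n ≡.≡ n′ ℕ.+ d
    n≡n′+d = ≡.sym (≡.trans (ℕₚ.+-comm n′ d) (ℕₚ.m+[n∸m]≡n d≤n))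
    tail< : ∀ {k} → k < d → n′ ℕ.+ k < n
    tail< k<d = ℕₚ.<-≤-trans (ℕₚ.+-monoʳ-< n′ k<d) (ℕₚ.≤-reflexive (≡.sym n≡n′+d))
    tail≥ : ∀ k → n ≤ (n′ ℕ.+ k) ℕ.+ d
    tail≥ k = ℕₚ.≤-trans (ℕₚ.≤-reflexive n≡n′+d) (ℕₚ.+-monoˡ-≤ d (ℕₚ.m≤m+n n′ k))
    head< : ∀ {k} → k < n′ → k ℕ.+ d < n
    head< k<n′ = ℕₚ.<-≤-trans (ℕₚ.+-monoˡ-< d k<n′) (ℕₚ.≤-reflexive (≡.sym n≡n′+d))

open import Relation.Binary.PropositionalEquality hiding ([_])
open import Data.Integer as ℤ using (ℤ; +_; -[1+_]; _+_; _-_; _*_; -_; _⊓_; ∣_∣)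
import Data.Integer.Properties as ℤₚ
open import Data.Integer.Tactic.RingSolver using (solve-∀)
open import Data.List using ([]; _∷_; foldr; applyUpTo)
open import Data.Product using (_×_; _,_)
open import Data.Maybe using (Maybe; just; nothing)
import Data.Maybe as Maybe
open import Level using (0ℓ)
open import Tactic.RingSolver.Core.AlmostCommutativeRing using (AlmostCommutativeRing; fromCommutativeRing)
import Tactic.RingSolver as RingSolver

-- Equalities of (Laurent) polynomials are coefficientwise and wrapped in records, so that
-- Agda can recover both sides from a proof (needed for setoid reasoning and the ring solver).
infix 4 _≈P_
record _≈P_ (p r : Poly) : Set where
  constructor mk≈P
  field coeffP-≡ : ∀ i → coeffP p i ≡ coeffP r i
open _≈P_

≈P-refl : ∀ {p} → p ≈P p
≈P-refl = mk≈P λ _ → refl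

≈P-sym : ∀ {p r} → p ≈P r → r ≈P p
≈P-sym e = mk≈P λ i → sym (coeffP-≡ e i)

≈P-trans : ∀ {p r s} → p ≈P r → r ≈P s → p ≈P s
≈P-trans e f = mk≈P λ i → trans (coeffP-≡ e i) (coeffP-≡ f i)

∷-cong : ∀ {a b p r} → a ≡ b → p ≈P r → a ∷ p ≈P b ∷ r
∷-cong {a} {b} {p} {r} a≡b p≈r = mk≈P coeffs
  where
  coeffs : ∀ i → coeffP (a ∷ p) i ≡ coeffP (b ∷ r) i
  coeffs zero    = a≡b
  coeffs (suc i) = coeffP-≡ p≈r i

coeffP-addP : ∀ p r i → coeffP (addP p r) i ≡ coeffP p i + coeffP r i
coeffP-addP []      r       i       = sym (ℤₚ.+-identityˡ _)
coeffP-addP (a ∷ p) []      i       = sym (ℤₚ.+-identityʳ _)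
coeffP-addP (a ∷ p) (b ∷ r) zero    = refl
coeffP-addP (a ∷ p) (b ∷ r) (suc i) = coeffP-addP p r i

coeffP-scaleP : ∀ c p i → coeffP (scaleP c p) i ≡ c * coeffP p i
coeffP-scaleP c []      i       = sym (ℤₚ.*-zeroʳ c)
coeffP-scaleP c (a ∷ p) zero    = refl
coeffP-scaleP c (a ∷ p) (suc i) = coeffP-scaleP c p i

addP-cong : ∀ {p p′ r r′} → p ≈P p′ → r ≈P r′ → addP p r ≈P addP p′ r′
addP-cong {p} {p′} {r} {r′} e f = mk≈P λ i → begin
  coeffP (addP p r) i           ≡⟨ coeffP-addP p r i ⟩
  coeffP p i + coeffP r i       ≡⟨ cong₂ _+_ (coeffP-≡ e i) (coeffP-≡ f i) ⟩
  coeffP p′ i + coeffP r′ i     ≡⟨ coeffP-addP p′ r′ i ⟨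
  coeffP (addP p′ r′) i         ∎
  where open ≡-Reasoning

scaleP-cong : ∀ c {p p′} → p ≈P p′ → scaleP c p ≈P scaleP c p′
scaleP-cong c {p} {p′} e = mk≈P λ i → begin
  coeffP (scaleP c p) i   ≡⟨ coeffP-scaleP c p i ⟩
  c * coeffP p i          ≡⟨ cong (c *_) (coeffP-≡ e i) ⟩
  c * coeffP p′ i         ≡⟨ coeffP-scaleP c p′ i ⟨
  coeffP (scaleP c p′) i  ∎
  where open ≡-Reasoning

shiftP-[] : ∀ k → shiftP k [] ≈P []
shiftP-[] k = mk≈P (coeffs k)
  where
  coeffs : ∀ k i → coeffP (shiftP k []) i ≡ + 0
  coeffs zero    i       = refl
  coeffs (suc k) zero    = refl
  coeffs (suc k) (suc i) = coeffs k i

scaleP-zero : ∀ p → scaleP (+ 0) p ≈P []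
scaleP-zero p = mk≈P λ i → trans (coeffP-scaleP (+ 0) p i) (ℤₚ.*-zeroˡ (coeffP p i))

scaleP-assoc : ∀ a b p → scaleP (a * b) p ≈P scaleP a (scaleP b p)
scaleP-assoc a b p = mk≈P λ i → begin
  coeffP (scaleP (a * b) p) i    ≡⟨ coeffP-scaleP (a * b) p i ⟩
  a * b * coeffP p i             ≡⟨ ℤₚ.*-assoc a b (coeffP p i) ⟩
  a * (b * coeffP p i)           ≡⟨ cong (a *_) (coeffP-scaleP b p i) ⟨
  a * coeffP (scaleP b p) i      ≡⟨ coeffP-scaleP a (scaleP b p) i ⟨
  coeffP (scaleP a (scaleP b p)) i ∎
  where open ≡-Reasoning

scaleP-distrib-addP : ∀ a p r → scaleP a (addP p r) ≈P addP (scaleP a p) (scaleP a r)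
scaleP-distrib-addP a p r = mk≈P λ i → begin
  coeffP (scaleP a (addP p r)) i                ≡⟨ coeffP-scaleP a (addP p r) i ⟩
  a * coeffP (addP p r) i                       ≡⟨ cong (a *_) (coeffP-addP p r i) ⟩
  a * (coeffP p i + coeffP r i)                 ≡⟨ ℤₚ.*-distribˡ-+ a (coeffP p i) (coeffP r i) ⟩
  a * coeffP p i + a * coeffP r i               ≡⟨ cong₂ _+_ (coeffP-scaleP a p i) (coeffP-scaleP a r i) ⟨
  coeffP (scaleP a p) i + coeffP (scaleP a r) i ≡⟨ coeffP-addP (scaleP a p) (scaleP a r) i ⟨
  coeffP (addP (scaleP a p) (scaleP a r)) i     ∎
  where open ≡-Reasoning

addP-leftComm : ∀ p r s → addP p (addP r s) ≈P addP r (addP p s)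
addP-leftComm p r s = mk≈P λ i → begin
  coeffP (addP p (addP r s)) i                ≡⟨ coeffP-addP p (addP r s) i ⟩
  coeffP p i + coeffP (addP r s) i            ≡⟨ cong (λ z → coeffP p i + z) (coeffP-addP r s i) ⟩
  coeffP p i + (coeffP r i + coeffP s i)      ≡⟨ leftComm (coeffP p i) (coeffP r i) (coeffP s i) ⟩
  coeffP r i + (coeffP p i + coeffP s i)      ≡⟨ cong (λ z → coeffP r i + z) (coeffP-addP p s i) ⟨
  coeffP r i + coeffP (addP p s) i            ≡⟨ coeffP-addP r (addP p s) i ⟨
  coeffP (addP r (addP p s)) i                ∎
  where
  open ≡-Reasoning
  leftComm : ∀ x y z → x + (y + z) ≡ y + (x + z)
  leftComm = solve-∀

addP-interchange : ∀ p r s t → addP (addP p r) (addP s t) ≈P addP (addP p s) (addP r t)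
addP-interchange p r s t = mk≈P λ i → begin
  coeffP (addP (addP p r) (addP s t)) i
    ≡⟨ trans (coeffP-addP (addP p r) (addP s t) i) (cong₂ _+_ (coeffP-addP p r i) (coeffP-addP s t i)) ⟩
  (coeffP p i + coeffP r i) + (coeffP s i + coeffP t i)
    ≡⟨ interchange (coeffP p i) (coeffP r i) (coeffP s i) (coeffP t i) ⟩
  (coeffP p i + coeffP s i) + (coeffP r i + coeffP t i)
    ≡⟨ trans (coeffP-addP (addP p s) (addP r t) i) (cong₂ _+_ (coeffP-addP p s i) (coeffP-addP r t i)) ⟨
  coeffP (addP (addP p s) (addP r t)) i ∎
  where
  open ≡-Reasoning
  interchange : ∀ w x y z → (w + x) + (y + z) ≡ (w + y) + (x + z)
  interchange = solve-∀

mulP-zeroʳ : ∀ p → mulP p [] ≈P []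
mulP-zeroʳ []      = ≈P-refl
mulP-zeroʳ (a ∷ p) = ≈P-trans (∷-cong refl (mulP-zeroʳ p)) (shiftP-[] 1)

mulP-0∷ˡ : ∀ p r → mulP (+ 0 ∷ p) r ≈P + 0 ∷ mulP p r
mulP-0∷ˡ p r = addP-cong (scaleP-zero r) ≈P-refl

mulP-∷ʳ : ∀ p b r → mulP p (b ∷ r) ≈P addP (scaleP b p) (+ 0 ∷ mulP p r)
mulP-∷ʳ []      b r = ≈P-sym (shiftP-[] 1)
mulP-∷ʳ (a ∷ p) b r =
  ∷-cong (cong (_+ + 0) (ℤₚ.*-comm a b))
         (≈P-trans (addP-cong ≈P-refl (mulP-∷ʳ p b r)) (addP-leftComm (scaleP a r) (scaleP b p) _))

mulP-comm : ∀ p r → mulP p r ≈P mulP r p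
mulP-comm []      r = ≈P-sym (mulP-zeroʳ r)
mulP-comm (a ∷ p) r = ≈P-trans (addP-cong ≈P-refl (∷-cong refl (mulP-comm p r))) (≈P-sym (mulP-∷ʳ r a p))

mulP-congʳ : ∀ p {r r′} → r ≈P r′ → mulP p r ≈P mulP p r′
mulP-congʳ []      e = ≈P-refl
mulP-congʳ (a ∷ p) e = addP-cong (scaleP-cong a e) (∷-cong refl (mulP-congʳ p e))

mulP-congˡ : ∀ {p p′} r → p ≈P p′ → mulP p r ≈P mulP p′ r
mulP-congˡ {p} {p′} r e = ≈P-trans (mulP-comm p r) (≈P-trans (mulP-congʳ r e) (mulP-comm r p′))

mulP-distribˡ : ∀ p r s → mulP p (addP r s) ≈P addP (mulP p r) (mulP p s)
mulP-distribˡ []      r s = ≈P-refl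
mulP-distribˡ (a ∷ p) r s =
  ≈P-trans (addP-cong (scaleP-distrib-addP a r s) (∷-cong refl (mulP-distribˡ p r s)))
           (addP-interchange (scaleP a r) (scaleP a s) (+ 0 ∷ mulP p r) (+ 0 ∷ mulP p s))

mulP-distribʳ : ∀ p r s → mulP (addP r s) p ≈P addP (mulP r p) (mulP s p)
mulP-distribʳ p r s =
  ≈P-trans (mulP-comm (addP r s) p)
           (≈P-trans (mulP-distribˡ p r s) (addP-cong (mulP-comm p r) (mulP-comm p s)))

mulP-scalePˡ : ∀ a r s → mulP (scaleP a r) s ≈P scaleP a (mulP r s)
mulP-scalePˡ a []      s = ≈P-refl
mulP-scalePˡ a (b ∷ r) s =
  ≈P-trans (addP-cong (scaleP-assoc a b s) (∷-cong (sym (ℤₚ.*-zeroʳ a)) (mulP-scalePˡ a r s)))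
           (≈P-sym (scaleP-distrib-addP a (scaleP b s) (+ 0 ∷ mulP r s)))

mulP-assoc : ∀ p r s → mulP (mulP p r) s ≈P mulP p (mulP r s)
mulP-assoc []      r s = ≈P-refl
mulP-assoc (a ∷ p) r s =
  ≈P-trans (mulP-distribʳ s (scaleP a r) (+ 0 ∷ mulP p r))
           (addP-cong (mulP-scalePˡ a r s)
                      (≈P-trans (mulP-0∷ˡ (mulP p r) s) (∷-cong refl (mulP-assoc p r s))))

mulP-identityˡ : ∀ p → mulP (+ 1 ∷ []) p ≈P p
mulP-identityˡ p = mk≈P λ i → begin
  coeffP (addP (scaleP (+ 1) p) (+ 0 ∷ [])) i         ≡⟨ coeffP-addP (scaleP (+ 1) p) (+ 0 ∷ []) i ⟩
  coeffP (scaleP (+ 1) p) i + coeffP (+ 0 ∷ []) i     ≡⟨ cong₂ _+_ (coeffP-scaleP (+ 1) p i) (coeffP-≡ (shiftP-[] 1) i) ⟩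
  + 1 * coeffP p i + + 0                              ≡⟨ ℤₚ.+-identityʳ _ ⟩
  + 1 * coeffP p i                                    ≡⟨ ℤₚ.*-identityˡ _ ⟩
  coeffP p i                                          ∎
  where open ≡-Reasoning

mulP-shiftPˡ : ∀ k p r → mulP (shiftP k p) r ≈P shiftP k (mulP p r)
mulP-shiftPˡ zero    p r = ≈P-refl
mulP-shiftPˡ (suc k) p r = ≈P-trans (mulP-0∷ˡ (shiftP k p) r) (∷-cong refl (mulP-shiftPˡ k p r))

coeffℤ : Poly → ℤ → ℤ
coeffℤ p (+ i)    = coeffP p i
coeffℤ p -[1+ _ ] = + 0

coeff-laurent : ∀ s p e → coeff (laurent s p) e ≡ coeffℤ p (e - s)
coeff-laurent s p e with e - s
... | + i      = refl
... | -[1+ _ ] = refl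

coeffℤ-cong : ∀ {p r} → p ≈P r → ∀ z → coeffℤ p z ≡ coeffℤ r z
coeffℤ-cong e (+ i)    = coeffP-≡ e i
coeffℤ-cong e -[1+ _ ] = refl

coeffℤ-[] : ∀ z → coeffℤ [] z ≡ + 0
coeffℤ-[] (+ _)    = refl
coeffℤ-[] -[1+ _ ] = refl

coeffℤ-addP : ∀ p r z → coeffℤ (addP p r) z ≡ coeffℤ p z + coeffℤ r z
coeffℤ-addP p r (+ i)    = coeffP-addP p r i
coeffℤ-addP p r -[1+ _ ] = refl

coeffℤ-scaleP : ∀ c p z → coeffℤ (scaleP c p) z ≡ c * coeffℤ p z
coeffℤ-scaleP c p (+ i)    = coeffP-scaleP c p i
coeffℤ-scaleP c p -[1+ _ ] = sym (ℤₚ.*-zeroʳ c)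

coeffℤ-0∷ : ∀ p z → coeffℤ (+ 0 ∷ p) (+ 1 + z) ≡ coeffℤ p z
coeffℤ-0∷ p (+ i)          = refl
coeffℤ-0∷ p -[1+ zero ]    = refl
coeffℤ-0∷ p -[1+ suc _ ]   = refl

infix 4 _≋_
record _≋_ (x y : Laurent) : Set where
  constructor mk≋
  field ≋⇒≈L : x ≈L y
open _≋_

≋-refl : ∀ {x} → x ≋ x
≋-refl = mk≋ λ _ → refl

≋-sym : ∀ {x y} → x ≋ y → y ≋ x
≋-sym x≋y = mk≋ λ e → sym (≋⇒≈L x≋y e)

≋-trans : ∀ {x y z} → x ≋ y → y ≋ z → x ≋ z
≋-trans x≋y y≋z = mk≋ λ e → trans (≋⇒≈L x≋y e) (≋⇒≈L y≋z e)

≋-reflexive : ∀ {x y} → x ≡ y → x ≋ y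
≋-reflexive refl = ≋-refl

laurent-cong : ∀ s {p r} → p ≈P r → laurent s p ≋ laurent s r
laurent-cong s {p} {r} p≈r = mk≋ λ e → begin
  coeff (laurent s p) e   ≡⟨ coeff-laurent s p e ⟩
  coeffℤ p (e - s)        ≡⟨ coeffℤ-cong p≈r (e - s) ⟩
  coeffℤ r (e - s)        ≡⟨ coeff-laurent s r e ⟨
  coeff (laurent s r) e   ∎
  where open ≡-Reasoning

laurent-low-≡ : ∀ {s t} p → s ≡ t → laurent s p ≋ laurent t p
laurent-low-≡ p s≡t = ≋-reflexive (cong (λ s → laurent s p) s≡t)

laurent-≋⇒≈P : ∀ {t p r} → laurent t p ≋ laurent t r → p ≈P r
laurent-≋⇒≈P {t} {p} {r} p≋r = mk≈P λ i → begin
  coeffP p i                          ≡⟨ cong (coeffℤ p) (index i) ⟩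
  coeffℤ p ((t + + i) - t)            ≡⟨ coeff-laurent t p (t + + i) ⟨
  coeff (laurent t p) (t + + i)       ≡⟨ ≋⇒≈L p≋r (t + + i) ⟩
  coeff (laurent t r) (t + + i)       ≡⟨ coeff-laurent t r (t + + i) ⟩
  coeffℤ r ((t + + i) - t)            ≡⟨ cong (coeffℤ r) (index i) ⟨
  coeffP r i                          ∎
  where
  open ≡-Reasoning
  index : ∀ i → + i ≡ (t + + i) - t
  index i = x≡[t+x]-t t (+ i)
    where
    x≡[t+x]-t : ∀ t x → x ≡ (t + x) - t
    x≡[t+x]-t = solve-∀

laurent-0∷ : ∀ t p → laurent t (+ 0 ∷ p) ≋ laurent (t + + 1) p
laurent-0∷ t p = mk≋ λ e → begin
  coeff (laurent t (+ 0 ∷ p)) e               ≡⟨ coeff-laurent t (+ 0 ∷ p) e ⟩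
  coeffℤ (+ 0 ∷ p) (e - t)                    ≡⟨ cong (coeffℤ (+ 0 ∷ p)) (index e t) ⟩
  coeffℤ (+ 0 ∷ p) (+ 1 + (e - (t + + 1)))    ≡⟨ coeffℤ-0∷ p (e - (t + + 1)) ⟩
  coeffℤ p (e - (t + + 1))                    ≡⟨ coeff-laurent (t + + 1) p e ⟨
  coeff (laurent (t + + 1) p) e               ∎
  where
  open ≡-Reasoning
  index : ∀ e t → e - t ≡ + 1 + (e - (t + + 1))
  index = solve-∀

laurent-shiftP : ∀ t k p → laurent t (shiftP k p) ≋ laurent (t + + k) p
laurent-shiftP t zero    p = laurent-low-≡ p (sym (ℤₚ.+-identityʳ t))
laurent-shiftP t (suc k) p =
  ≋-trans (laurent-0∷ t (shiftP k p))
          (≋-trans (laurent-shiftP (t + + 1) k p) (laurent-low-≡ p (ℤₚ.+-assoc t (+ 1) (+ k))))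

t+∣s-t∣≡s : ∀ {t s} → t ℤ.≤ s → t + + ∣ s - t ∣ ≡ s
t+∣s-t∣≡s {t} {s} t≤s = trans (cong (λ d → t + d) (ℤₚ.0≤i⇒+∣i∣≡i (ℤₚ.i≤j⇒0≤j-i t≤s))) (gap t s)
  where
  gap : ∀ t s → t + (s - t) ≡ s
  gap = solve-∀

laurent-rebase : ∀ {t s} p → t ℤ.≤ s → laurent s p ≋ laurent t (shiftP ∣ s - t ∣ p)
laurent-rebase p t≤s = ≋-sym (≋-trans (laurent-shiftP _ _ p) (laurent-low-≡ p (t+∣s-t∣≡s t≤s)))

coeff-+L : ∀ x y e → coeff (x +L y) e ≡ coeff x e + coeff y e
coeff-+L (laurent s p) (laurent u r) e = begin
  coeff (laurent t (addP P R)) e                  ≡⟨ coeff-laurent t (addP P R) e ⟩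
  coeffℤ (addP P R) (e - t)                       ≡⟨ coeffℤ-addP P R (e - t) ⟩
  coeffℤ P (e - t) + coeffℤ R (e - t)             ≡⟨ cong₂ _+_ (coeff-laurent t P e) (coeff-laurent t R e) ⟨
  coeff (laurent t P) e + coeff (laurent t R) e   ≡⟨ cong₂ _+_ (≋⇒≈L (laurent-rebase p (ℤₚ.i⊓j≤i s u)) e)
                                                               (≋⇒≈L (laurent-rebase r (ℤₚ.i⊓j≤j s u)) e) ⟨
  coeff (laurent s p) e + coeff (laurent u r) e   ∎
  where
  open ≡-Reasoning
  t = s ⊓ u
  P = shiftP ∣ s - t ∣ p
  R = shiftP ∣ u - t ∣ r

laurent-addP : ∀ s p r → laurent s (addP p r) ≋ laurent s p +L laurent s r
laurent-addP s p r = mk≋ λ e → begin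
  coeff (laurent s (addP p r)) e                  ≡⟨ coeff-laurent s (addP p r) e ⟩
  coeffℤ (addP p r) (e - s)                       ≡⟨ coeffℤ-addP p r (e - s) ⟩
  coeffℤ p (e - s) + coeffℤ r (e - s)             ≡⟨ cong₂ _+_ (coeff-laurent s p e) (coeff-laurent s r e) ⟨
  coeff (laurent s p) e + coeff (laurent s r) e   ≡⟨ coeff-+L (laurent s p) (laurent s r) e ⟨
  coeff (laurent s p +L laurent s r) e            ∎
  where open ≡-Reasoning

coeff-0L : ∀ e → coeff 0L e ≡ + 0
coeff-0L e = trans (coeff-laurent (+ 0) [] e) (coeffℤ-[] (e - + 0))

laurent-[] : ∀ s → laurent s [] ≋ 0L
laurent-[] s = mk≋ λ e → trans (coeff-laurent s [] e) (trans (coeffℤ-[] (e - s)) (sym (coeff-0L e)))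

+L-cong : ∀ {x x′ y y′} → x ≋ x′ → y ≋ y′ → x +L y ≋ x′ +L y′
+L-cong {x} {x′} {y} {y′} x≋x′ y≋y′ = mk≋ λ e → begin
  coeff (x +L y) e            ≡⟨ coeff-+L x y e ⟩
  coeff x e + coeff y e       ≡⟨ cong₂ _+_ (≋⇒≈L x≋x′ e) (≋⇒≈L y≋y′ e) ⟩
  coeff x′ e + coeff y′ e     ≡⟨ coeff-+L x′ y′ e ⟨
  coeff (x′ +L y′) e          ∎
  where open ≡-Reasoning

+L-congˡ : ∀ x {y y′} → y ≋ y′ → x +L y ≋ x +L y′
+L-congˡ x = +L-cong (≋-refl {x})

+L-congʳ : ∀ {x x′} y → x ≋ x′ → x +L y ≋ x′ +L y
+L-congʳ y x≋x′ = +L-cong x≋x′ (≋-refl {y})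

+L-comm : ∀ x y → x +L y ≋ y +L x
+L-comm x y = mk≋ λ e → begin
  coeff (x +L y) e         ≡⟨ coeff-+L x y e ⟩
  coeff x e + coeff y e    ≡⟨ ℤₚ.+-comm (coeff x e) (coeff y e) ⟩
  coeff y e + coeff x e    ≡⟨ coeff-+L y x e ⟨
  coeff (y +L x) e         ∎
  where open ≡-Reasoning

+L-assoc : ∀ x y z → (x +L y) +L z ≋ x +L (y +L z)
+L-assoc x y z = mk≋ λ e → begin
  coeff ((x +L y) +L z) e                  ≡⟨ coeff-+L (x +L y) z e ⟩
  coeff (x +L y) e + coeff z e             ≡⟨ cong (_+ coeff z e) (coeff-+L x y e) ⟩
  coeff x e + coeff y e + coeff z e        ≡⟨ ℤₚ.+-assoc (coeff x e) (coeff y e) (coeff z e) ⟩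
  coeff x e + (coeff y e + coeff z e)      ≡⟨ cong (λ c → coeff x e + c) (coeff-+L y z e) ⟨
  coeff x e + coeff (y +L z) e             ≡⟨ coeff-+L x (y +L z) e ⟨
  coeff (x +L (y +L z)) e                  ∎
  where open ≡-Reasoning

+L-identityˡ : ∀ x → 0L +L x ≋ x
+L-identityˡ x = mk≋ λ e → begin
  coeff (0L +L x) e        ≡⟨ coeff-+L 0L x e ⟩
  coeff 0L e + coeff x e   ≡⟨ cong (_+ coeff x e) (coeff-0L e) ⟩
  + 0 + coeff x e          ≡⟨ ℤₚ.+-identityˡ (coeff x e) ⟩
  coeff x e                ∎
  where open ≡-Reasoning

+L-identityʳ : ∀ x → x +L 0L ≋ x
+L-identityʳ x = ≋-trans (+L-comm x 0L) (+L-identityˡ x)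

infix 8 -L_
-L_ : Laurent → Laurent
-L laurent s p = laurent s (scaleP (- + 1) p)

coeff--L : ∀ x e → coeff (-L x) e ≡ - coeff x e
coeff--L (laurent s p) e = begin
  coeff (laurent s (scaleP (- + 1) p)) e   ≡⟨ coeff-laurent s (scaleP (- + 1) p) e ⟩
  coeffℤ (scaleP (- + 1) p) (e - s)        ≡⟨ coeffℤ-scaleP (- + 1) p (e - s) ⟩
  - + 1 * coeffℤ p (e - s)                 ≡⟨ ℤₚ.-1*i≡-i (coeffℤ p (e - s)) ⟩
  - coeffℤ p (e - s)                       ≡⟨ cong -_ (coeff-laurent s p e) ⟨
  - coeff (laurent s p) e                  ∎
  where open ≡-Reasoning

-L-cong : ∀ {x y} → x ≋ y → -L x ≋ -L y
-L-cong {x} {y} x≋y = mk≋ λ e →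
  trans (coeff--L x e) (trans (cong -_ (≋⇒≈L x≋y e)) (sym (coeff--L y e)))

-L-inverseˡ : ∀ x → -L x +L x ≋ 0L
-L-inverseˡ x = mk≋ λ e → begin
  coeff (-L x +L x) e          ≡⟨ coeff-+L (-L x) x e ⟩
  coeff (-L x) e + coeff x e   ≡⟨ cong (_+ coeff x e) (coeff--L x e) ⟩
  - coeff x e + coeff x e      ≡⟨ ℤₚ.+-inverseˡ (coeff x e) ⟩
  + 0                          ≡⟨ coeff-0L e ⟨
  coeff 0L e                   ∎
  where open ≡-Reasoning

-L-inverseʳ : ∀ x → x +L -L x ≋ 0L
-L-inverseʳ x = ≋-trans (+L-comm x (-L x)) (-L-inverseˡ x)

*L-comm : ∀ x y → x *L y ≋ y *L x
*L-comm (laurent s p) (laurent u r) =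
  ≋-trans (laurent-low-≡ (mulP p r) (ℤₚ.+-comm s u)) (laurent-cong (u + s) (mulP-comm p r))

*L-assoc : ∀ x y z → (x *L y) *L z ≋ x *L (y *L z)
*L-assoc (laurent s p) (laurent u r) (laurent v w) =
  ≋-trans (laurent-low-≡ (mulP (mulP p r) w) (ℤₚ.+-assoc s u v)) (laurent-cong _ (mulP-assoc p r w))

*L-shiftPˡ : ∀ t k p y → laurent t (shiftP k p) *L y ≋ laurent (t + + k) p *L y
*L-shiftPˡ t k p (laurent u r) =
  ≋-trans (laurent-cong (t + u) (mulP-shiftPˡ k p r))
          (≋-trans (laurent-shiftP (t + u) k (mulP p r)) (laurent-low-≡ (mulP p r) (exponent t u (+ k))))
  where
  exponent : ∀ t u k → t + u + k ≡ t + k + u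
  exponent = solve-∀

*L-rebaseˡ : ∀ {t s} p y → t ℤ.≤ s → laurent s p *L y ≋ laurent t (shiftP ∣ s - t ∣ p) *L y
*L-rebaseˡ {t} p y t≤s = ≋-sym (≋-trans (*L-shiftPˡ t _ p y) (≋-reflexive (cong (λ s → laurent s p *L y) (t+∣s-t∣≡s t≤s))))

*L-congˡ : ∀ {x x′} y → x ≋ x′ → x *L y ≋ x′ *L y
*L-congˡ {laurent s p} {laurent s′ p′} y@(laurent u r) x≋x′ =
  ≋-trans (*L-rebaseˡ p y t≤s)
          (≋-trans (laurent-cong (t + u) (mulP-congˡ r P≈P′)) (≋-sym (*L-rebaseˡ p′ y t≤s′)))
  where
  t    = s ⊓ s′
  t≤s  = ℤₚ.i⊓j≤i s s′
  t≤s′ = ℤₚ.i⊓j≤j s s′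
  P≈P′ : shiftP (∣ s - t ∣) p ≈P shiftP (∣ s′ - t ∣) p′
  P≈P′ = laurent-≋⇒≈P (≋-trans (≋-sym (laurent-rebase p t≤s)) (≋-trans x≋x′ (laurent-rebase p′ t≤s′)))

*L-congʳ : ∀ x {y y′} → y ≋ y′ → x *L y ≋ x *L y′
*L-congʳ x {y} {y′} y≋y′ = ≋-trans (*L-comm x y) (≋-trans (*L-congˡ x y≋y′) (*L-comm y′ x))

*L-distribˡ : ∀ x y z → x *L (y +L z) ≋ x *L y +L x *L z
*L-distribˡ x@(laurent s p) y@(laurent u r) z@(laurent v w) =
  ≋-trans (laurent-cong (s + t) (mulP-distribˡ p R W))
          (≋-trans (laurent-addP (s + t) (mulP p R) (mulP p W))
                   (+L-cong (*L-congʳ x (≋-sym (laurent-rebase r (ℤₚ.i⊓j≤i u v))))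
                            (*L-congʳ x (≋-sym (laurent-rebase w (ℤₚ.i⊓j≤j u v))))))
  where
  t = u ⊓ v
  R = shiftP ∣ u - t ∣ r
  W = shiftP ∣ v - t ∣ w

*L-distribʳ : ∀ x y z → (y +L z) *L x ≋ y *L x +L z *L x
*L-distribʳ x y z =
  ≋-trans (*L-comm (y +L z) x) (≋-trans (*L-distribˡ x y z) (+L-cong (*L-comm x y) (*L-comm x z)))

*L-cong : ∀ {x x′ y y′} → x ≋ x′ → y ≋ y′ → x *L y ≋ x′ *L y′
*L-cong {x} {x′} {y} x≋x′ y≋y′ = ≋-trans (*L-congˡ y x≋x′) (*L-congʳ x′ y≋y′)

*L-zeroʳ : ∀ x → x *L 0L ≋ 0L
*L-zeroʳ (laurent s p) = ≋-trans (laurent-cong (s + + 0) (mulP-zeroʳ p)) (laurent-[] (s + + 0))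

*L-zeroˡ : ∀ x → 0L *L x ≋ 0L
*L-zeroˡ x = ≋-trans (*L-comm 0L x) (*L-zeroʳ x)

*L-vanishˡ : ∀ {x} y → x ≋ 0L → x *L y ≋ 0L
*L-vanishˡ y x≋0 = ≋-trans (*L-congˡ y x≋0) (*L-zeroˡ y)

*L-vanishʳ : ∀ x {y} → y ≋ 0L → x *L y ≋ 0L
*L-vanishʳ x y≋0 = ≋-trans (*L-congʳ x y≋0) (*L-zeroʳ x)

1L : Laurent
1L = constL (+ 1)

*L-identityˡ : ∀ x → 1L *L x ≋ x
*L-identityˡ (laurent s p) =
  ≋-trans (laurent-cong (+ 0 + s) (mulP-identityˡ p)) (laurent-low-≡ p (ℤₚ.+-identityˡ s))

*L-identityʳ : ∀ x → x *L 1L ≋ x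
*L-identityʳ x = ≋-trans (*L-comm x 1L) (*L-identityˡ x)

Laurent-commutativeRing : CommutativeRing 0ℓ 0ℓ
Laurent-commutativeRing = record
  { Carrier = Laurent
  ; _≈_ = _≋_
  ; _+_ = _+L_
  ; _*_ = _*L_
  ; -_ = -L_
  ; 0# = 0L
  ; 1# = 1L
  ; isCommutativeRing = record
    { isRing = record
      { +-isAbelianGroup = record
        { isGroup = record
          { isMonoid = record
            { isSemigroup = record
              { isMagma = record
                { isEquivalence = record { refl = ≋-refl ; sym = ≋-sym ; trans = ≋-trans }
                ; ∙-cong = +L-cong }
              ; assoc = +L-assoc }
            ; identity = +L-identityˡ , +L-identityʳ }
          ; inverse = -L-inverseˡ , -L-inverseʳ
          ; ⁻¹-cong = -L-cong }
        ; comm = +L-comm }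
      ; *-cong = *L-cong
      ; *-assoc = *L-assoc
      ; *-identity = *L-identityˡ , *L-identityʳ
      ; distrib = *L-distribˡ , *L-distribʳ }
    ; *-comm = *L-comm }
  }

-- The solver needs to recognise vanishing coefficients; a syntactically zero polynomial suffices.
≈P-[]? : ∀ p → Maybe (p ≈P [])
≈P-[]? []                = just ≈P-refl
≈P-[]? (+ zero ∷ p)      = Maybe.map (λ p≈[] → ≈P-trans (∷-cong refl p≈[]) (shiftP-[] 1)) (≈P-[]? p)
≈P-[]? (+ suc _ ∷ _)     = nothing
≈P-[]? (-[1+ _ ] ∷ _)    = nothing

0L≋? : ∀ x → Maybe (0L ≋ x)
0L≋? (laurent s p) = Maybe.map (λ p≈[] → ≋-sym (≋-trans (laurent-cong s p≈[]) (laurent-[] s))) (≈P-[]? p)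

Laurent-acr : AlmostCommutativeRing 0ℓ 0ℓ
Laurent-acr = fromCommutativeRing Laurent-commutativeRing 0L≋?

open RangeSum (CommutativeRing.semiring Laurent-commutativeRing)
open import Relation.Binary.Reasoning.Setoid (CommutativeRing.setoid Laurent-commutativeRing)

-- Monomials and q-binomials are opaque, so that Laurent expressions built from them are not
-- unfolded during unification and the ring solver treats them as atoms.  The q-binomials are
-- used only through the defining recursion proved in the unfolding block below.
opaque
  q^ : ℤ → Laurent
  q^ = qpow

  [_,_] : ℤ → ℤ → Laurent
  [ n , k ] = qbin n k

opaque
  unfolding q^ [_,_]

  q^≡qpow : ∀ e → q^ e ≡ qpow e
  q^≡qpow e = refl

  [,]≡qbin : ∀ n k → [ n , k ] ≡ qbin n k
  [,]≡qbin n k = refl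

  q^-+ : ∀ a b → q^ a *L q^ b ≋ q^ (a + b)
  q^-+ a b = ≋-refl

  q^-0 : q^ (+ 0) ≋ 1L
  q^-0 = ≋-refl

  [,]-neg : ∀ N j → [ N , -[1+ j ] ] ≋ 0L
  [,]-neg (+ _)    j = ≋-refl
  [,]-neg -[1+ _ ] j = ≋-refl

  [,]-0 : ∀ n → [ + n , + 0 ] ≋ 1L
  [,]-0 n = ≋-refl

  [0,suc] : ∀ k → [ + 0 , + suc k ] ≋ 0L
  [0,suc] k = ≋-refl

  [,]-pascal : ∀ n k → [ + suc n , + suc k ] ≋ [ + n , + k ] +L q^ (+ suc k) *L [ + n , + suc k ]
  [,]-pascal n k =
    ≋-trans (laurent-addP (+ 0) (qbinN n k) (shiftP (suc k) (qbinN n (suc k))))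
            (+L-congˡ (laurent (+ 0) (qbinN n k)) (≋-sym (q^-*L-shiftP (suc k) (qbinN n (suc k)))))
    where
    q^-*L-shiftP : ∀ k p → qpow (+ k) *L laurent (+ 0) p ≋ laurent (+ 0) (shiftP k p)
    q^-*L-shiftP k p =
      ≋-trans (laurent-cong (+ k + + 0) (mulP-identityˡ p))
              (≋-sym (≋-trans (laurent-shiftP (+ 0) k p) (laurent-low-≡ p (ℤₚ.+-comm (+ 0) (+ k)))))

q^-cong : ∀ {a b} → a ≡ b → q^ a ≋ q^ b
q^-cong refl = ≋-refl

q^-*L-cong : ∀ {a b c d} → a + b ≡ c + d → q^ a *L q^ b ≋ q^ c *L q^ d
q^-*L-cong {a} {b} {c} {d} eq = ≋-trans (q^-+ a b) (≋-trans (q^-cong eq) (≋-sym (q^-+ c d)))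

[,]-cong : ∀ {n n′ k k′} → n ≡ n′ → k ≡ k′ → [ n , k ] ≋ [ n′ , k′ ]
[,]-cong refl refl = ≋-refl

[,]-> : ∀ {n k} → n < k → [ + n , + k ] ≋ 0L
[,]-> {zero}  {suc k} _          = [0,suc] k
[,]-> {suc n} {suc k} (s≤s n<k) = begin
  [ + suc n , + suc k ]                                ≈⟨ [,]-pascal n k ⟩
  [ + n , + k ] +L q^ (+ suc k) *L [ + n , + suc k ]   ≈⟨ +L-cong ([,]-> n<k) (*L-vanishʳ (q^ (+ suc k)) ([,]-> (ℕₚ.m<n⇒m<1+n n<k))) ⟩
  0L +L 0L                                             ≈⟨ +L-identityˡ 0L ⟩
  0L                                                   ∎

[,]-diag : ∀ n → [ + n , + n ] ≋ 1L
[,]-diag zero    = [,]-0 0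
[,]-diag (suc n) = begin
  [ + suc n , + suc n ]                                ≈⟨ [,]-pascal n n ⟩
  [ + n , + n ] +L q^ (+ suc n) *L [ + n , + suc n ]   ≈⟨ +L-cong ([,]-diag n) (*L-vanishʳ (q^ (+ suc n)) ([,]-> (ℕₚ.n<1+n n))) ⟩
  1L +L 0L                                             ≈⟨ +L-identityʳ 1L ⟩
  1L                                                   ∎

[,]-pascalℤ : ∀ n K → [ + suc n , K ] ≋ [ + n , K - + 1 ] +L q^ K *L [ + n , K ]
[,]-pascalℤ n (+ suc k) = [,]-pascal n k
[,]-pascalℤ n (+ zero)  = begin
  [ + suc n , + 0 ]                                    ≈⟨ [,]-0 (suc n) ⟩
  1L                                                   ≈⟨ *L-identityˡ 1L ⟨
  1L *L 1L                                             ≈⟨ +L-identityˡ (1L *L 1L) ⟨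
  0L +L 1L *L 1L                                       ≈⟨ +L-cong ([,]-neg (+ n) 0) (*L-cong q^-0 ([,]-0 n)) ⟨
  [ + n , -[1+ 0 ] ] +L q^ (+ 0) *L [ + n , + 0 ]      ∎
[,]-pascalℤ n -[1+ j ]  = begin
  [ + suc n , -[1+ j ] ]                               ≈⟨ [,]-neg (+ suc n) j ⟩
  0L                                                   ≈⟨ +L-identityˡ 0L ⟨
  0L +L 0L                                             ≈⟨ +L-cong ([,]-neg (+ n) _) (*L-vanishʳ (q^ -[1+ j ]) ([,]-neg (+ n) j)) ⟨
  [ + n , -[1+ j ] - + 1 ] +L q^ -[1+ j ] *L [ + n , -[1+ j ] ] ∎

[1,]-pascal′ : ∀ K → [ + 1 , K ] ≋ q^ (+ 1 - K) *L [ + 0 , K - + 1 ] +L [ + 0 , K ]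
[1,]-pascal′ (+ zero)        = begin
  [ + 1 , + 0 ]                                          ≈⟨ [,]-0 1 ⟩
  1L                                                     ≈⟨ +L-identityˡ 1L ⟨
  0L +L 1L                                               ≈⟨ +L-cong (*L-vanishʳ (q^ (+ 1)) ([,]-neg (+ 0) 0)) ([,]-0 0) ⟨
  q^ (+ 1) *L [ + 0 , -[1+ 0 ] ] +L [ + 0 , + 0 ]        ∎
[1,]-pascal′ (+ suc zero)    = begin
  [ + 1 , + 1 ]                                          ≈⟨ [,]-diag 1 ⟩
  1L                                                     ≈⟨ *L-identityˡ 1L ⟨
  1L *L 1L                                               ≈⟨ +L-identityʳ (1L *L 1L) ⟨
  1L *L 1L +L 0L                                         ≈⟨ +L-cong (*L-cong q^-0 ([,]-0 0)) ([0,suc] 0) ⟨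
  q^ (+ 0) *L [ + 0 , + 0 ] +L [ + 0 , + 1 ]             ∎
[1,]-pascal′ (+ suc (suc k)) = begin
  [ + 1 , + suc (suc k) ]                                ≈⟨ [,]-> (s≤s (s≤s z≤n)) ⟩
  0L                                                     ≈⟨ +L-identityˡ 0L ⟨
  0L +L 0L                                               ≈⟨ +L-cong (*L-vanishʳ X ([0,suc] k)) ([0,suc] (suc k)) ⟨
  X *L [ + 0 , + suc k ] +L [ + 0 , + suc (suc k) ]      ∎
  where X = q^ (+ 1 - + suc (suc k))
[1,]-pascal′ -[1+ j ]        = begin
  [ + 1 , -[1+ j ] ]                                     ≈⟨ [,]-neg (+ 1) j ⟩
  0L                                                     ≈⟨ +L-identityˡ 0L ⟨
  0L +L 0L                                               ≈⟨ +L-cong (*L-vanishʳ X ([,]-neg (+ 0) _)) ([,]-neg (+ 0) j) ⟨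
  X *L [ + 0 , -[1+ j ] - + 1 ] +L [ + 0 , -[1+ j ] ]    ∎
  where X = q^ (+ 1 - -[1+ j ])

[,]-pascal′ : ∀ n K → [ + suc n , K ] ≋ q^ (+ suc n - K) *L [ + n , K - + 1 ] +L [ + n , K ]
[,]-pascal′ zero    K = [1,]-pascal′ K
[,]-pascal′ (suc n) K = begin
  [ + suc (suc n) , K ]
    ≈⟨ [,]-pascalℤ (suc n) K ⟩
  [ + suc n , K - + 1 ] +L q^ K *L [ + suc n , K ]
    ≈⟨ +L-cong ([,]-pascal′ n (K - + 1)) (*L-congʳ (q^ K) ([,]-pascal′ n K)) ⟩
  (q^ (+ suc n - (K - + 1)) *L a +L b) +L q^ K *L (q^ (+ suc n - K) *L b +L c)
    ≈⟨ +L-congʳ _ (+L-congʳ b (*L-congˡ a (q^-cong (exponent₁ (+ n) K)))) ⟩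
  (X *L a +L b) +L q^ K *L (q^ (+ suc n - K) *L b +L c)
    ≈⟨ expand X a b (q^ K) (q^ (+ suc n - K)) c ⟩
  X *L a +L (q^ K *L q^ (+ suc n - K)) *L b +L (b +L q^ K *L c)
    ≈⟨ +L-congʳ (b +L q^ K *L c) (+L-congˡ (X *L a) (*L-congˡ b (q^-*L-cong (exponent₂ (+ n) K)))) ⟩
  X *L a +L (X *L q^ (K - + 1)) *L b +L (b +L q^ K *L c)
    ≈⟨ collect X a (q^ (K - + 1)) b (q^ K) c ⟩
  X *L (a +L q^ (K - + 1) *L b) +L (b +L q^ K *L c)
    ≈⟨ +L-cong (*L-congʳ X ([,]-pascalℤ n (K - + 1))) ([,]-pascalℤ n K) ⟨
  X *L [ + suc n , K - + 1 ] +L [ + suc n , K ]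
    ∎
  where
  X = q^ (+ suc (suc n) - K)
  a = [ + n , K - + 1 - + 1 ]
  b = [ + n , K - + 1 ]
  c = [ + n , K ]
  exponent₁ : ∀ n K → (+ 1 + n) - (K - + 1) ≡ (+ 1 + (+ 1 + n)) - K
  exponent₁ = solve-∀
  exponent₂ : ∀ n K → K + ((+ 1 + n) - K) ≡ ((+ 1 + (+ 1 + n)) - K) + (K - + 1)
  exponent₂ = solve-∀
  expand : ∀ X a b Y Z c → (X *L a +L b) +L Y *L (Z *L b +L c) ≋ X *L a +L (Y *L Z) *L b +L (b +L Y *L c)
  expand = RingSolver.solve-∀ Laurent-acr
  collect : ∀ X a W b Y c → X *L a +L (X *L W) *L b +L (b +L Y *L c) ≋ X *L (a +L W *L b) +L (b +L Y *L c)
  collect = RingSolver.solve-∀ Laurent-acr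

[,]-sym : ∀ n K → [ + n , K ] ≋ [ + n , + n - K ]
[,]-sym zero (+ zero)    = ≋-refl
[,]-sym zero (+ suc k)   = ≋-trans ([0,suc] k) (≋-sym ([,]-neg (+ 0) k))
[,]-sym zero -[1+ j ]    = ≋-trans ([,]-neg (+ 0) j) (≋-sym ([0,suc] j))
[,]-sym (suc n) K = begin
  [ + suc n , K ]                                       ≈⟨ [,]-pascalℤ n K ⟩
  [ + n , K - + 1 ] +L q^ K *L [ + n , K ]              ≈⟨ +L-cong ([,]-sym n (K - + 1)) (*L-congʳ (q^ K) ([,]-sym n K)) ⟩
  [ + n , + n - (K - + 1) ] +L q^ K *L [ + n , + n - K ] ≈⟨ +L-comm _ _ ⟩
  q^ K *L [ + n , + n - K ] +L [ + n , + n - (K - + 1) ]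
    ≈⟨ +L-cong (*L-cong (q^-cong (K≡[1+n]-K′ (+ n) K)) ([,]-cong refl (n-K≡K′-1 (+ n) K)))
               ([,]-cong refl (n-[K-1]≡K′ (+ n) K)) ⟩
  q^ (+ suc n - K′) *L [ + n , K′ - + 1 ] +L [ + n , K′ ]  ≈⟨ [,]-pascal′ n K′ ⟨
  [ + suc n , K′ ]                                       ∎
  where
  K′ = + suc n - K
  K≡[1+n]-K′ : ∀ n K → K ≡ (+ 1 + n) - ((+ 1 + n) - K)
  K≡[1+n]-K′ = solve-∀
  n-K≡K′-1 : ∀ n K → n - K ≡ (+ 1 + n) - K - + 1
  n-K≡K′-1 = solve-∀
  n-[K-1]≡K′ : ∀ n K → n - (K - + 1) ≡ (+ 1 + n) - K
  n-[K-1]≡K′ = solve-∀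

[,]-consecutive : ∀ n K → (1L +L -L q^ K) *L [ + n , K ] ≋ (1L +L -L q^ (+ suc n - K)) *L [ + n , K - + 1 ]
[,]-consecutive n K = begin
  (1L +L -L X) *L b                 ≈⟨ split X a b ⟩
  (a +L b) +L -L (a +L X *L b)      ≈⟨ +L-congˡ (a +L b) (-L-cong (≋-trans (≋-sym ([,]-pascalℤ n K)) ([,]-pascal′ n K))) ⟩
  (a +L b) +L -L (Y *L a +L b)      ≈⟨ merge Y a b ⟩
  (1L +L -L Y) *L a                 ∎
  where
  X = q^ K
  Y = q^ (+ suc n - K)
  a = [ + n , K - + 1 ]
  b = [ + n , K ]
  split : ∀ X a b → (1L +L -L X) *L b ≋ (a +L b) +L -L (a +L X *L b)
  split = RingSolver.solve-∀ Laurent-acr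
  merge : ∀ Y a b → (a +L b) +L -L (Y *L a +L b) ≋ (1L +L -L Y) *L a
  merge = RingSolver.solve-∀ Laurent-acr

[,]-absorption : ∀ n K → (1L +L -L q^ K) *L [ + suc n , K ] ≋ (1L +L -L q^ (+ suc n)) *L [ + n , K - + 1 ]
[,]-absorption n K = begin
  (1L +L -L X) *L B                          ≈⟨ split X B ⟩
  B +L -L (X *L B)                           ≈⟨ +L-cong ([,]-pascalℤ n K) (-L-cong (*L-congʳ X ([,]-pascal′ n K))) ⟩
  (a +L X *L b) +L -L (X *L (Y *L a +L b))   ≈⟨ merge X Y a b ⟩
  (1L +L -L (X *L Y)) *L a                   ≈⟨ *L-congˡ a (+L-congˡ 1L (-L-cong (≋-trans (q^-+ K _) (q^-cong (exponent K (+ n)))))) ⟩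
  (1L +L -L q^ (+ suc n)) *L a               ∎
  where
  X = q^ K
  Y = q^ (+ suc n - K)
  a = [ + n , K - + 1 ]
  b = [ + n , K ]
  B = [ + suc n , K ]
  split : ∀ X B → (1L +L -L X) *L B ≋ B +L -L (X *L B)
  split = RingSolver.solve-∀ Laurent-acr
  merge : ∀ X Y a b → (a +L X *L b) +L -L (X *L (Y *L a +L b)) ≋ (1L +L -L (X *L Y)) *L a
  merge = RingSolver.solve-∀ Laurent-acr
  exponent : ∀ K n → K + ((+ 1 + n) - K) ≡ + 1 + n
  exponent = solve-∀

[,]-contiguous : ∀ ℓ K →
  [ + ℓ , K - + 1 ] +L q^ (K + K - + ℓ) *L [ + suc ℓ , K + + 1 ] ≋ [ + suc ℓ , K ] +L q^ (K + K - + ℓ) *L [ + ℓ , K + + 1 ]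
[,]-contiguous ℓ K = begin
  a +L c *L [ + suc ℓ , K + + 1 ]
    ≈⟨ +L-congˡ a (*L-congʳ c ([,]-pascal′ ℓ (K + + 1))) ⟩
  a +L c *L (q^ (+ suc ℓ - (K + + 1)) *L [ + ℓ , K + + 1 - + 1 ] +L d)
    ≈⟨ distrib a c (q^ (+ suc ℓ - (K + + 1))) [ + ℓ , K + + 1 - + 1 ] d ⟩
  a +L (c *L q^ (+ suc ℓ - (K + + 1))) *L [ + ℓ , K + + 1 - + 1 ] +L c *L d
    ≈⟨ +L-congʳ (c *L d) (+L-congˡ a (*L-cong (≋-trans (q^-+ _ _) (q^-cong (exponent K (+ ℓ)))) ([,]-cong refl (K+1-1≡K K)))) ⟩
  a +L q^ K *L [ + ℓ , K ] +L c *L d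
    ≈⟨ +L-congʳ (c *L d) ([,]-pascalℤ ℓ K) ⟨
  [ + suc ℓ , K ] +L c *L d
    ∎
  where
  a = [ + ℓ , K - + 1 ]
  c = q^ (K + K - + ℓ)
  d = [ + ℓ , K + + 1 ]
  exponent : ∀ K ℓ → K + K - ℓ + ((+ 1 + ℓ) - (K + + 1)) ≡ K
  exponent = solve-∀
  K+1-1≡K : ∀ K → K + + 1 - + 1 ≡ K
  K+1-1≡K = solve-∀
  distrib : ∀ X c Y W V → X +L c *L (Y *L W +L V) ≋ X +L (c *L Y) *L W +L c *L V
  distrib = RingSolver.solve-∀ Laurent-acr

[+n]-[+i]≡+[n∸i] : ∀ {n i} → i ≤ n → + n - + i ≡ + (n ℕ.∸ i)
[+n]-[+i]≡+[n∸i] {n} {i} i≤n = trans (ℤₚ.[+m]-[+n]≡m⊖n n i) (ℤₚ.⊖-≥ i≤n)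

qtrinomial : ℕ → ℕ → ℕ → Laurent
qtrinomial n x y = [ + n , + x ] *L [ + (n ℕ.∸ x) , + y ]

qtrinomial-pascal : ∀ n x y →
  qtrinomial (suc n) (suc x) (suc y) ≋
  qtrinomial n x (suc y) +L q^ (+ suc x) *L qtrinomial n (suc x) y
    +L (q^ (+ suc x) *L q^ (+ suc y)) *L qtrinomial n (suc x) (suc y)
qtrinomial-pascal n x y = begin
  [ + suc n , + suc x ] *L [ + (n ℕ.∸ x) , + suc y ]
    ≈⟨ *L-congˡ [ + (n ℕ.∸ x) , + suc y ] ([,]-pascal n x) ⟩
  ([ + n , + x ] +L X *L [ + n , + suc x ]) *L [ + (n ℕ.∸ x) , + suc y ]
    ≈⟨ distrib [ + n , + x ] X [ + n , + suc x ] [ + (n ℕ.∸ x) , + suc y ] ⟩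
  qtrinomial n x (suc y) +L X *L ([ + n , + suc x ] *L [ + (n ℕ.∸ x) , + suc y ])
    ≈⟨ +L-congˡ (qtrinomial n x (suc y)) (*L-congʳ X second-pascal) ⟩
  qtrinomial n x (suc y) +L X *L ([ + n , + suc x ] *L ([ + M , + y ] +L Y *L [ + M , + suc y ]))
    ≈⟨ regroup (qtrinomial n x (suc y)) X Y [ + n , + suc x ] [ + M , + y ] [ + M , + suc y ] ⟩
  qtrinomial n x (suc y) +L X *L qtrinomial n (suc x) y +L (X *L Y) *L qtrinomial n (suc x) (suc y)
    ∎
  where
  X = q^ (+ suc x)
  Y = q^ (+ suc y)
  M = n ℕ.∸ suc x
  distrib : ∀ a X b c → (a +L X *L b) *L c ≋ a *L c +L X *L (b *L c)
  distrib = RingSolver.solve-∀ Laurent-acr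
  regroup : ∀ t X Y b c d → t +L X *L (b *L (c +L Y *L d)) ≋ t +L X *L (b *L c) +L (X *L Y) *L (b *L d)
  regroup = RingSolver.solve-∀ Laurent-acr
  second-pascal : [ + n , + suc x ] *L [ + (n ℕ.∸ x) , + suc y ] ≋ [ + n , + suc x ] *L ([ + M , + y ] +L Y *L [ + M , + suc y ])
  second-pascal with ℕₚ.<-≤-connex x n
  ... | inj₁ x<n = *L-congʳ [ + n , + suc x ]
                     (≋-trans ([,]-cong (cong +_ (ℕₚ.+-∸-assoc 1 x<n)) refl) ([,]-pascal M y))
  ... | inj₂ n≤x = ≋-trans (*L-vanishˡ [ + (n ℕ.∸ x) , + suc y ] ([,]-> (s≤s n≤x)))
                           (≋-sym (*L-vanishˡ ([ + M , + y ] +L Y *L [ + M , + suc y ]) ([,]-> (s≤s n≤x))))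

qtrinomial-absorption : ∀ n x y →
  (1L +L -L q^ (+ suc y)) *L qtrinomial n x (suc y) ≋ (1L +L -L q^ (+ suc x)) *L qtrinomial n (suc x) y
qtrinomial-absorption n x y with ℕₚ.<-≤-connex x n
... | inj₁ x<n = begin
  (1L +L -L Y) *L ([ + n , + x ] *L [ + (n ℕ.∸ x) , + suc y ])
    ≈⟨ *L-congʳ (1L +L -L Y) (*L-congʳ [ + n , + x ] ([,]-cong (cong +_ n∸x≡1+M) refl)) ⟩
  (1L +L -L Y) *L ([ + n , + x ] *L [ + suc M , + suc y ])
    ≈⟨ left-comm (1L +L -L Y) [ + n , + x ] [ + suc M , + suc y ] ⟩
  [ + n , + x ] *L ((1L +L -L Y) *L [ + suc M , + suc y ])
    ≈⟨ *L-congʳ [ + n , + x ] ([,]-absorption M (+ suc y)) ⟩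
  [ + n , + x ] *L ((1L +L -L q^ (+ suc M)) *L [ + M , + y ])
    ≈⟨ *L-congʳ [ + n , + x ] (*L-congˡ [ + M , + y ] (+L-congˡ 1L (-L-cong (q^-cong 1+M≡[1+n]-[1+x])))) ⟩
  [ + n , + x ] *L ((1L +L -L q^ (+ suc n - + suc x)) *L [ + M , + y ])
    ≈⟨ left-comm [ + n , + x ] (1L +L -L q^ (+ suc n - + suc x)) [ + M , + y ] ⟩
  (1L +L -L q^ (+ suc n - + suc x)) *L ([ + n , + x ] *L [ + M , + y ])
    ≈⟨ *-assoc⁻¹ (1L +L -L q^ (+ suc n - + suc x)) [ + n , + x ] [ + M , + y ] ⟩
  ((1L +L -L q^ (+ suc n - + suc x)) *L [ + n , + x ]) *L [ + M , + y ]
    ≈⟨ *L-congˡ [ + M , + y ] ([,]-consecutive n (+ suc x)) ⟨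
  ((1L +L -L X) *L [ + n , + suc x ]) *L [ + M , + y ]
    ≈⟨ *L-assoc (1L +L -L X) [ + n , + suc x ] [ + M , + y ] ⟩
  (1L +L -L X) *L qtrinomial n (suc x) y
    ∎
  where
  X = q^ (+ suc x)
  Y = q^ (+ suc y)
  M = n ℕ.∸ suc x
  n∸x≡1+M : n ℕ.∸ x ≡ suc M
  n∸x≡1+M = ℕₚ.+-∸-assoc 1 x<n
  1+M≡[1+n]-[1+x] : + suc M ≡ + suc n - + suc x
  1+M≡[1+n]-[1+x] = sym (trans ([+n]-[+i]≡+[n∸i] (s≤s (ℕₚ.<⇒≤ x<n))) (cong +_ n∸x≡1+M))
  left-comm : ∀ a b c → a *L (b *L c) ≋ b *L (a *L c)
  left-comm = RingSolver.solve-∀ Laurent-acr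
  *-assoc⁻¹ : ∀ a b c → a *L (b *L c) ≋ (a *L b) *L c
  *-assoc⁻¹ = RingSolver.solve-∀ Laurent-acr
... | inj₂ n≤x = ≋-trans (*L-vanishʳ (1L +L -L q^ (+ suc y)) lhs≋0) (≋-sym (*L-vanishʳ (1L +L -L q^ (+ suc x)) rhs≋0))
  where
  lhs≋0 : qtrinomial n x (suc y) ≋ 0L
  lhs≋0 = *L-vanishʳ [ + n , + x ] (≋-trans ([,]-cong (cong +_ (ℕₚ.m≤n⇒m∸n≡0 n≤x)) refl) ([0,suc] y))
  rhs≋0 : qtrinomial n (suc x) y ≋ 0L
  rhs≋0 = *L-vanishˡ [ + (n ℕ.∸ suc x) , + y ] ([,]-> (s≤s n≤x))

qtrinomial-sym : ∀ n x y → qtrinomial n x y ≋ qtrinomial n y x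
qtrinomial-sym n       zero    y       =
  ≋-trans (*L-congˡ [ + n , + y ] ([,]-0 n))
          (≋-trans (*L-identityˡ [ + n , + y ]) (≋-sym (≋-trans (*L-congʳ [ + n , + y ] ([,]-0 (n ℕ.∸ y))) (*L-identityʳ [ + n , + y ]))))
qtrinomial-sym n       (suc x) zero    = ≋-sym (qtrinomial-sym n zero (suc x))
qtrinomial-sym zero    (suc x) (suc y) =
  ≋-trans (*L-vanishˡ [ + 0 , + suc y ] ([0,suc] x)) (≋-sym (*L-vanishˡ [ + 0 , + suc x ] ([0,suc] y)))
qtrinomial-sym (suc n) (suc x) (suc y) = begin
  qtrinomial (suc n) (suc x) (suc y)              ≈⟨ qtrinomial-pascal n x y ⟩
  A +L X *L C +L (X *L Y) *L D                    ≈⟨ insert A C D X Y ⟩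
  (1L +L -L Y) *L A +L Y *L A +L X *L C +L (X *L Y) *L D
    ≈⟨ +L-congʳ _ (+L-congʳ _ (+L-congʳ _ (qtrinomial-absorption n x y))) ⟩
  (1L +L -L X) *L C +L Y *L A +L X *L C +L (X *L Y) *L D
    ≈⟨ cancel A C D X Y ⟩
  C +L Y *L A +L (Y *L X) *L D
    ≈⟨ +L-cong (+L-cong (qtrinomial-sym n (suc x) y) (*L-congʳ Y (qtrinomial-sym n x (suc y))))
               (*L-congʳ (Y *L X) (qtrinomial-sym n (suc x) (suc y))) ⟩
  qtrinomial n y (suc x) +L Y *L qtrinomial n (suc y) x +L (Y *L X) *L qtrinomial n (suc y) (suc x)
    ≈⟨ qtrinomial-pascal n y x ⟨
  qtrinomial (suc n) (suc y) (suc x)              ∎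
  where
  X = q^ (+ suc x)
  Y = q^ (+ suc y)
  A = qtrinomial n x (suc y)
  C = qtrinomial n (suc x) y
  D = qtrinomial n (suc x) (suc y)
  insert : ∀ A C D X Y → A +L X *L C +L (X *L Y) *L D ≋ (1L +L -L Y) *L A +L Y *L A +L X *L C +L (X *L Y) *L D
  insert = RingSolver.solve-∀ Laurent-acr
  cancel : ∀ A C D X Y → (1L +L -L X) *L C +L Y *L A +L X *L C +L (X *L Y) *L D ≋ C +L Y *L A +L (Y *L X) *L D
  cancel = RingSolver.solve-∀ Laurent-acr

-- Opaque for the same reason as q^ and [_,_].
opaque
  summand : ℤ → ℤ → ℤ → ℤ → ℤ → Laurent
  summand e a b c d = q^ e *L [ a , b ] *L [ c , d ]

summand-cong : ∀ {e e′ a a′ b b′ c c′ d d′} → e ≡ e′ → a ≡ a′ → b ≡ b′ → c ≡ c′ → d ≡ d′ →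
               summand e a b c d ≋ summand e′ a′ b′ c′ d′
summand-cong refl refl refl refl refl = ≋-refl

opaque
  unfolding summand

  summand-vanish₁ : ∀ e {a b} c d → [ a , b ] ≋ 0L → summand e a b c d ≋ 0L
  summand-vanish₁ e c d [a,b]≋0 = *L-vanishˡ [ c , d ] (*L-vanishʳ (q^ e) [a,b]≋0)

  summand-vanish₂ : ∀ e a b {c d} → [ c , d ] ≋ 0L → summand e a b c d ≋ 0L
  summand-vanish₂ e a b [c,d]≋0 = *L-vanishʳ (q^ e *L [ a , b ]) [c,d]≋0

  summand-q^ : ∀ c e a b x y → q^ c *L summand e a b x y ≋ summand (c + e) a b x y
  summand-q^ c e a b x y = ≋-trans (assoc (q^ c) (q^ e) [ a , b ] [ x , y ]) (*L-congˡ [ x , y ] (*L-congˡ [ a , b ] (q^-+ c e)))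
    where
    assoc : ∀ C E A X → C *L (E *L A *L X) ≋ (C *L E) *L A *L X
    assoc = RingSolver.solve-∀ Laurent-acr

  summand-pascal : ∀ e n K c d → summand e (+ suc n) K c d ≋ summand e (+ n) (K - + 1) c d +L summand (e + K) (+ n) K c d
  summand-pascal e n K c d = begin
    q^ e *L [ + suc n , K ] *L [ c , d ]
      ≈⟨ *L-congˡ [ c , d ] (*L-congʳ (q^ e) ([,]-pascalℤ n K)) ⟩
    q^ e *L ([ + n , K - + 1 ] +L q^ K *L [ + n , K ]) *L [ c , d ]
      ≈⟨ distrib (q^ e) [ + n , K - + 1 ] (q^ K) [ + n , K ] [ c , d ] ⟩
    summand e (+ n) (K - + 1) c d +L (q^ e *L q^ K) *L [ + n , K ] *L [ c , d ]
      ≈⟨ +L-congˡ (summand e (+ n) (K - + 1) c d) (*L-congˡ [ c , d ] (*L-congˡ [ + n , K ] (q^-+ e K))) ⟩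
    summand e (+ n) (K - + 1) c d +L summand (e + K) (+ n) K c d
      ∎
    where
    distrib : ∀ Q A P B Z → Q *L (A +L P *L B) *L Z ≋ Q *L A *L Z +L (Q *L P) *L B *L Z
    distrib = RingSolver.solve-∀ Laurent-acr

  summand-pascal′ : ∀ e a b N K →
    summand e a b (+ suc N) K ≋ summand (e + (+ suc N - K)) a b (+ N) (K - + 1) +L summand e a b (+ N) K
  summand-pascal′ e a b N K = begin
    q^ e *L [ a , b ] *L [ + suc N , K ]
      ≈⟨ *L-congʳ (q^ e *L [ a , b ]) ([,]-pascal′ N K) ⟩
    q^ e *L [ a , b ] *L (q^ (+ suc N - K) *L [ + N , K - + 1 ] +L [ + N , K ])
      ≈⟨ distrib (q^ e) [ a , b ] (q^ (+ suc N - K)) [ + N , K - + 1 ] [ + N , K ] ⟩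
    (q^ e *L q^ (+ suc N - K)) *L [ a , b ] *L [ + N , K - + 1 ] +L summand e a b (+ N) K
      ≈⟨ +L-congʳ (summand e a b (+ N) K) (*L-congˡ [ + N , K - + 1 ] (*L-congˡ [ a , b ] (q^-+ e (+ suc N - K)))) ⟩
    summand (e + (+ suc N - K)) a b (+ N) (K - + 1) +L summand e a b (+ N) K
      ∎
    where
    distrib : ∀ Q A Y X Z → Q *L A *L (Y *L X +L Z) ≋ (Q *L Y) *L A *L X +L Q *L A *L Z
    distrib = RingSolver.solve-∀ Laurent-acr

  summand-0 : ∀ c d → summand (+ 0) (+ 0) (+ 0) c d ≋ [ c , d ]
  summand-0 c d = ≋-trans (*L-congˡ [ c , d ] (*L-cong q^-0 ([,]-0 0))) (unit [ c , d ])
    where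
    unit : ∀ x → 1L *L 1L *L x ≋ x
    unit = RingSolver.solve-∀ Laurent-acr

  summand-trinomial-sym : ∀ e n x y → summand e (+ n) (+ x) (+ (n ℕ.∸ x)) (+ y) ≋ summand e (+ n) (+ y) (+ (n ℕ.∸ y)) (+ x)
  summand-trinomial-sym e n x y = begin
    q^ e *L [ + n , + x ] *L [ + (n ℕ.∸ x) , + y ]   ≈⟨ *L-assoc (q^ e) [ + n , + x ] [ + (n ℕ.∸ x) , + y ] ⟩
    q^ e *L qtrinomial n x y                          ≈⟨ *L-congʳ (q^ e) (qtrinomial-sym n x y) ⟩
    q^ e *L qtrinomial n y x                          ≈⟨ *L-assoc (q^ e) [ + n , + y ] [ + (n ℕ.∸ y) , + x ] ⟨
    q^ e *L [ + n , + y ] *L [ + (n ℕ.∸ y) , + x ]   ∎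

  summand≡qpow : ∀ e a b c d → summand e a b c d ≡ qpow e *L qbin a b *L qbin c d
  summand≡qpow e a b c d = cong₂ _*L_ (cong₂ _*L_ (q^≡qpow e) ([,]≡qbin a b)) ([,]≡qbin c d)

lhs₁-term : ℕ → ℕ → ℤ → ℕ → Laurent
lhs₁-term ℓ n m k =
  summand ((+ k - + n) * (+ 2 * + k + + ℓ + + 2 * m - + n)) (+ n) (+ k) (+ ℓ - + k) (+ k + + ℓ + m - + n)

rhs₁-term : ℕ → ℕ → ℤ → ℕ → Laurent
rhs₁-term ℓ n m k =
  summand (+ k * (+ 2 * + k - + ℓ - + 2 * m - + n)) (+ n) (+ k) (+ ℓ - + k) (+ k - m)

lhs₁ : ℕ → ℕ → ℤ → Laurent
lhs₁ ℓ n m = Σ< (suc n) (lhs₁-term ℓ n m)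

rhs₁ : ℕ → ℕ → ℤ → Laurent
rhs₁ ℓ n m = Σ< (suc n) (rhs₁-term ℓ n m)

lhs₁-term-pascal : ∀ ℓ n m k →
  lhs₁-term (suc ℓ) (suc n) m k ≋
  delayed (lhs₁-term ℓ n (m + + 1)) k +L q^ (- (+ ℓ + + 2 * m)) *L lhs₁-term (suc ℓ) n (m - + 1) k
lhs₁-term-pascal ℓ n m k =
  ≋-trans (summand-pascal (E k) n (+ k) (C k) (D k)) (+L-cong (first k) second)
  where
  E : ℕ → ℤ
  E k = (+ k - + suc n) * (+ 2 * + k + + suc ℓ + + 2 * m - + suc n)
  C : ℕ → ℤ
  C k = + suc ℓ - + k
  D : ℕ → ℤ
  D k = + k + + suc ℓ + m - + suc n
  e₁ : ∀ j n ℓ m → ((+ 1 + j) - (+ 1 + n)) * (+ 2 * (+ 1 + j) + (+ 1 + ℓ) + + 2 * m - (+ 1 + n))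
                   ≡ (j - n) * (+ 2 * j + ℓ + + 2 * (m + + 1) - n)
  e₁ = solve-∀
  b₁ : ∀ j → (+ 1 + j) - + 1 ≡ j
  b₁ = solve-∀
  c₁ : ∀ j ℓ → (+ 1 + ℓ) - (+ 1 + j) ≡ ℓ - j
  c₁ = solve-∀
  d₁ : ∀ j n ℓ m → (+ 1 + j) + (+ 1 + ℓ) + m - (+ 1 + n) ≡ j + ℓ + (m + + 1) - n
  d₁ = solve-∀
  first : ∀ k → summand (E k) (+ n) (+ k - + 1) (C k) (D k) ≋ delayed (lhs₁-term ℓ n (m + + 1)) k
  first zero    = summand-vanish₁ (E 0) (C 0) (D 0) ([,]-neg (+ n) 0)
  first (suc j) = begin
    summand (E (suc j)) (+ n) (+ suc j - + 1) (C (suc j)) (D (suc j))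
      ≈⟨ summand-cong (e₁ (+ j) (+ n) (+ ℓ) m) refl (b₁ (+ j)) (c₁ (+ j) (+ ℓ)) (d₁ (+ j) (+ n) (+ ℓ) m) ⟩
    lhs₁-term ℓ n (m + + 1) j
      ∎
  e₂ : ∀ k n ℓ m → (k - (+ 1 + n)) * (+ 2 * k + (+ 1 + ℓ) + + 2 * m - (+ 1 + n)) + k
                   ≡ - (ℓ + + 2 * m) + (k - n) * (+ 2 * k + (+ 1 + ℓ) + + 2 * (m - + 1) - n)
  e₂ = solve-∀
  d₂ : ∀ k n ℓ m → k + (+ 1 + ℓ) + m - (+ 1 + n) ≡ k + (+ 1 + ℓ) + (m - + 1) - n
  d₂ = solve-∀
  second : summand (E k + + k) (+ n) (+ k) (C k) (D k) ≋ q^ (- (+ ℓ + + 2 * m)) *L lhs₁-term (suc ℓ) n (m - + 1) k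
  second = begin
    summand (E k + + k) (+ n) (+ k) (C k) (D k)
      ≈⟨ summand-cong (e₂ (+ k) (+ n) (+ ℓ) m) refl refl refl (d₂ (+ k) (+ n) (+ ℓ) m) ⟩
    summand (- (+ ℓ + + 2 * m) + (+ k - + n) * (+ 2 * + k + + suc ℓ + + 2 * (m - + 1) - + n))
            (+ n) (+ k) (+ suc ℓ - + k) (+ k + + suc ℓ + (m - + 1) - + n)
      ≈⟨ summand-q^ _ _ _ _ _ _ ⟨
    q^ (- (+ ℓ + + 2 * m)) *L lhs₁-term (suc ℓ) n (m - + 1) k
      ∎

rhs₁-term-pascal : ∀ ℓ n m k →
  rhs₁-term (suc ℓ) (suc n) m k ≋
  delayed (λ j → q^ (- (+ ℓ + + n + + 2 * m)) *L rhs₁-term ℓ n (m - + 1) j) k +L rhs₁-term (suc ℓ) n m k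
rhs₁-term-pascal ℓ n m k =
  ≋-trans (summand-pascal (E k) n (+ k) (C k) (+ k - m)) (+L-cong (first k) second)
  where
  E : ℕ → ℤ
  E k = + k * (+ 2 * + k - + suc ℓ - + 2 * m - + suc n)
  C : ℕ → ℤ
  C k = + suc ℓ - + k
  e₁ : ∀ j n ℓ m → (+ 1 + j) * (+ 2 * (+ 1 + j) - (+ 1 + ℓ) - + 2 * m - (+ 1 + n))
                   ≡ - (ℓ + n + + 2 * m) + j * (+ 2 * j - ℓ - + 2 * (m - + 1) - n)
  e₁ = solve-∀
  b₁ : ∀ j → (+ 1 + j) - + 1 ≡ j
  b₁ = solve-∀
  c₁ : ∀ j ℓ → (+ 1 + ℓ) - (+ 1 + j) ≡ ℓ - j
  c₁ = solve-∀
  d₁ : ∀ j m → (+ 1 + j) - m ≡ j - (m - + 1)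
  d₁ = solve-∀
  first : ∀ k → summand (E k) (+ n) (+ k - + 1) (C k) (+ k - m) ≋
                delayed (λ j → q^ (- (+ ℓ + + n + + 2 * m)) *L rhs₁-term ℓ n (m - + 1) j) k
  first zero    = summand-vanish₁ (E 0) (C 0) (+ 0 - m) ([,]-neg (+ n) 0)
  first (suc j) = begin
    summand (E (suc j)) (+ n) (+ suc j - + 1) (C (suc j)) (+ suc j - m)
      ≈⟨ summand-cong (e₁ (+ j) (+ n) (+ ℓ) m) refl (b₁ (+ j)) (c₁ (+ j) (+ ℓ)) (d₁ (+ j) m) ⟩
    summand (- (+ ℓ + + n + + 2 * m) + + j * (+ 2 * + j - + ℓ - + 2 * (m - + 1) - + n))
            (+ n) (+ j) (+ ℓ - + j) (+ j - (m - + 1))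
      ≈⟨ summand-q^ _ _ _ _ _ _ ⟨
    q^ (- (+ ℓ + + n + + 2 * m)) *L rhs₁-term ℓ n (m - + 1) j
      ∎
  e₂ : ∀ k n ℓ m → k * (+ 2 * k - (+ 1 + ℓ) - + 2 * m - (+ 1 + n)) + k ≡ k * (+ 2 * k - (+ 1 + ℓ) - + 2 * m - n)
  e₂ = solve-∀
  second : summand (E k + + k) (+ n) (+ k) (C k) (+ k - m) ≋ rhs₁-term (suc ℓ) n m k
  second = begin
    summand (E k + + k) (+ n) (+ k) (C k) (+ k - m)  ≈⟨ summand-cong (e₂ (+ k) (+ n) (+ ℓ) m) refl refl refl refl ⟩
    rhs₁-term (suc ℓ) n m k                          ∎

lhs₁-rec : ∀ ℓ n m → lhs₁ (suc ℓ) (suc n) m ≋ lhs₁ ℓ n (m + + 1) +L q^ (- (+ ℓ + + 2 * m)) *L lhs₁ (suc ℓ) n (m - + 1)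
lhs₁-rec ℓ n m = begin
  Σ< (suc (suc n)) (lhs₁-term (suc ℓ) (suc n) m)
    ≈⟨ Σ<-cong (suc (suc n)) (λ k _ → lhs₁-term-pascal ℓ n m k) ⟩
  Σ< (suc (suc n)) (λ k → delayed (lhs₁-term ℓ n (m + + 1)) k +L c *L lhs₁-term (suc ℓ) n (m - + 1) k)
    ≈⟨ Σ<-delayed-+ (suc n) (lhs₁-term ℓ n (m + + 1)) (λ k → c *L lhs₁-term (suc ℓ) n (m - + 1) k)
                    (*L-vanishʳ c (summand-vanish₁ _ _ _ ([,]-> (ℕₚ.n<1+n n)))) ⟩
  lhs₁ ℓ n (m + + 1) +L Σ< (suc n) (λ k → c *L lhs₁-term (suc ℓ) n (m - + 1) k)
    ≈⟨ +L-congˡ (lhs₁ ℓ n (m + + 1)) (Σ<-*ˡ (suc n) c (lhs₁-term (suc ℓ) n (m - + 1))) ⟩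
  lhs₁ ℓ n (m + + 1) +L c *L lhs₁ (suc ℓ) n (m - + 1)
    ∎
  where c = q^ (- (+ ℓ + + 2 * m))

rhs₁-rec : ∀ ℓ n m → rhs₁ (suc ℓ) (suc n) m ≋ rhs₁ (suc ℓ) n m +L q^ (- (+ ℓ + + n + + 2 * m)) *L rhs₁ ℓ n (m - + 1)
rhs₁-rec ℓ n m = begin
  Σ< (suc (suc n)) (rhs₁-term (suc ℓ) (suc n) m)
    ≈⟨ Σ<-cong (suc (suc n)) (λ k _ → rhs₁-term-pascal ℓ n m k) ⟩
  Σ< (suc (suc n)) (λ k → delayed (λ j → c *L rhs₁-term ℓ n (m - + 1) j) k +L rhs₁-term (suc ℓ) n m k)
    ≈⟨ Σ<-delayed-+ (suc n) (λ j → c *L rhs₁-term ℓ n (m - + 1) j) (rhs₁-term (suc ℓ) n m)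
                    (summand-vanish₁ _ _ _ ([,]-> (ℕₚ.n<1+n n))) ⟩
  Σ< (suc n) (λ j → c *L rhs₁-term ℓ n (m - + 1) j) +L rhs₁ (suc ℓ) n m
    ≈⟨ +L-comm (Σ< (suc n) (λ j → c *L rhs₁-term ℓ n (m - + 1) j)) (rhs₁ (suc ℓ) n m) ⟩
  rhs₁ (suc ℓ) n m +L Σ< (suc n) (λ j → c *L rhs₁-term ℓ n (m - + 1) j)
    ≈⟨ +L-congˡ (rhs₁ (suc ℓ) n m) (Σ<-*ˡ (suc n) c (rhs₁-term ℓ n (m - + 1))) ⟩
  rhs₁ (suc ℓ) n m +L c *L rhs₁ ℓ n (m - + 1)
    ∎
  where c = q^ (- (+ ℓ + + n + + 2 * m))

lhs₁-0 : ∀ ℓ m → lhs₁ ℓ 0 m ≋ [ + ℓ , + ℓ + m ]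
lhs₁-0 ℓ m = begin
  lhs₁-term ℓ 0 m 0 +L 0L
    ≈⟨ +L-identityʳ (lhs₁-term ℓ 0 m 0) ⟩
  summand (+ 0 * (+ 2 * + 0 + + ℓ + + 2 * m - + 0)) (+ 0) (+ 0) (+ ℓ - + 0) (+ 0 + + ℓ + m - + 0)
    ≈⟨ summand-cong (ℤₚ.*-zeroˡ (+ 2 * + 0 + + ℓ + + 2 * m - + 0)) refl refl (ℤₚ.+-identityʳ (+ ℓ)) (d (+ ℓ) m) ⟩
  summand (+ 0) (+ 0) (+ 0) (+ ℓ) (+ ℓ + m)
    ≈⟨ summand-0 (+ ℓ) (+ ℓ + m) ⟩
  [ + ℓ , + ℓ + m ]
    ∎
  where
  d : ∀ ℓ m → + 0 + ℓ + m - + 0 ≡ ℓ + m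
  d = solve-∀

rhs₁-0 : ∀ ℓ m → rhs₁ ℓ 0 m ≋ [ + ℓ , - m ]
rhs₁-0 ℓ m = begin
  rhs₁-term ℓ 0 m 0 +L 0L
    ≈⟨ +L-identityʳ (rhs₁-term ℓ 0 m 0) ⟩
  summand (+ 0 * (+ 2 * + 0 - + ℓ - + 2 * m - + 0)) (+ 0) (+ 0) (+ ℓ - + 0) (+ 0 - m)
    ≈⟨ summand-cong (ℤₚ.*-zeroˡ (+ 2 * + 0 - + ℓ - + 2 * m - + 0)) refl refl (ℤₚ.+-identityʳ (+ ℓ)) (ℤₚ.+-identityˡ (- m)) ⟩
  summand (+ 0) (+ 0) (+ 0) (+ ℓ) (- m)
    ≈⟨ summand-0 (+ ℓ) (- m) ⟩
  [ + ℓ , - m ]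
    ∎

rhs₁-contiguous : ∀ ℓ m N → N ≤ ℓ →
  rhs₁ ℓ N (m + + 1) +L q^ (- (+ ℓ + + 2 * m)) *L rhs₁ (suc ℓ) N (m - + 1) ≋
  rhs₁ (suc ℓ) N m +L q^ (- (+ ℓ + + N + + 2 * m)) *L rhs₁ ℓ N (m - + 1)
rhs₁-contiguous ℓ m zero z≤n = begin
  rhs₁ ℓ 0 (m + + 1) +L q^ (- (+ ℓ + + 2 * m)) *L rhs₁ (suc ℓ) 0 (m - + 1)
    ≈⟨ +L-cong (rhs₁-0 ℓ (m + + 1)) (*L-cong (q^-cong (c≡ (+ ℓ) m)) (rhs₁-0 (suc ℓ) (m - + 1))) ⟩
  [ + ℓ , - (m + + 1) ] +L c *L [ + suc ℓ , - (m - + 1) ]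
    ≈⟨ +L-cong ([,]-cong refl (index₁ m)) (*L-congʳ c ([,]-cong refl (index₂ m))) ⟩
  [ + ℓ , - m - + 1 ] +L c *L [ + suc ℓ , - m + + 1 ]
    ≈⟨ [,]-contiguous ℓ (- m) ⟩
  [ + suc ℓ , - m ] +L c *L [ + ℓ , - m + + 1 ]
    ≈⟨ +L-cong (rhs₁-0 (suc ℓ) m) (*L-cong (q^-cong (c≡′ (+ ℓ) m)) (≋-trans (rhs₁-0 ℓ (m - + 1)) ([,]-cong refl (index₂ m)))) ⟨
  rhs₁ (suc ℓ) 0 m +L q^ (- (+ ℓ + + 0 + + 2 * m)) *L rhs₁ ℓ 0 (m - + 1)
    ∎
  where
  c = q^ (- m + - m - + ℓ)
  c≡ : ∀ ℓ m → - (ℓ + + 2 * m) ≡ - m + - m - ℓ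
  c≡ = solve-∀
  c≡′ : ∀ ℓ m → - (ℓ + + 0 + + 2 * m) ≡ - m + - m - ℓ
  c≡′ = solve-∀
  index₁ : ∀ m → - (m + + 1) ≡ - m - + 1
  index₁ = solve-∀
  index₂ : ∀ m → - (m - + 1) ≡ - m + + 1
  index₂ = solve-∀
-- Expanding all four sums by rhs₁-rec regroups into the claim for (ℓ+1, m) and for (ℓ, m-1).
rhs₁-contiguous (suc ℓ) m (suc N) (s≤s N≤ℓ) = begin
  rhs₁ (suc ℓ) (suc N) (m + + 1) +L c₁ *L rhs₁ (suc (suc ℓ)) (suc N) (m - + 1)
    ≈⟨ +L-cong (rhs₁-rec ℓ N (m + + 1)) (*L-congʳ c₁ (rhs₁-rec (suc ℓ) N (m - + 1))) ⟩
  (A +L u *L rhs₁ ℓ N (m + + 1 - + 1)) +L c₁ *L (B +L w *L F)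
    ≈⟨ +L-congʳ (c₁ *L (B +L w *L F)) (+L-congˡ A (*L-congʳ u (≋-reflexive (cong (rhs₁ ℓ N) (m+1-1≡m m))))) ⟩
  (A +L u *L E) +L c₁ *L (B +L w *L F)
    ≈⟨ regroup A u E c₁ B w F ⟩
  (A +L c₁ *L B) +L u *L E +L (c₁ *L w) *L F
    ≈⟨ +L-congˡ ((A +L c₁ *L B) +L u *L E) (*L-congˡ F (q^-*L-cong (exponent (+ ℓ) (+ N) m))) ⟩
  (A +L c₁ *L B) +L u *L E +L (u *L v) *L F
    ≈⟨ factor (A +L c₁ *L B) u E v F ⟩
  (A +L c₁ *L B) +L u *L (E +L v *L F)
    ≈⟨ +L-cong (rhs₁-contiguous (suc ℓ) m N (ℕₚ.m≤n⇒m≤1+n N≤ℓ))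
               (*L-congʳ u (≋-trans (+L-congʳ (v *L F) (≋-reflexive (cong (rhs₁ ℓ N) (sym (m-1+1≡m m)))))
                                    (rhs₁-contiguous ℓ (m - + 1) N N≤ℓ))) ⟩
  (C +L d *L D) +L u *L (D +L w′ *L G)
    ≈⟨ +L-cong (rhs₁-rec (suc ℓ) N m) (*L-cong (q^-cong (c₄≡u (+ ℓ) (+ N) m)) (rhs₁-rec ℓ N (m - + 1))) ⟨
  rhs₁ (suc (suc ℓ)) (suc N) m +L q^ (- (+ suc ℓ + + suc N + + 2 * m)) *L rhs₁ (suc ℓ) (suc N) (m - + 1)
    ∎
  where
  c₁ = q^ (- (+ suc ℓ + + 2 * m))
  u  = q^ (- (+ ℓ + + N + + 2 * (m + + 1)))
  w  = q^ (- (+ suc ℓ + + N + + 2 * (m - + 1)))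
  v  = q^ (- (+ ℓ + + 2 * (m - + 1)))
  d  = q^ (- (+ suc ℓ + + N + + 2 * m))
  w′ = q^ (- (+ ℓ + + N + + 2 * (m - + 1)))
  A = rhs₁ (suc ℓ) N (m + + 1)
  B = rhs₁ (suc (suc ℓ)) N (m - + 1)
  C = rhs₁ (suc (suc ℓ)) N m
  D = rhs₁ (suc ℓ) N (m - + 1)
  E = rhs₁ ℓ N m
  F = rhs₁ (suc ℓ) N (m - + 1 - + 1)
  G = rhs₁ ℓ N (m - + 1 - + 1)
  m+1-1≡m : ∀ m → m + + 1 - + 1 ≡ m
  m+1-1≡m = solve-∀
  m-1+1≡m : ∀ m → m - + 1 + + 1 ≡ m
  m-1+1≡m = solve-∀
  exponent : ∀ ℓ N m → - ((+ 1 + ℓ) + + 2 * m) + - ((+ 1 + ℓ) + N + + 2 * (m - + 1))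
                       ≡ - (ℓ + N + + 2 * (m + + 1)) + - (ℓ + + 2 * (m - + 1))
  exponent = solve-∀
  c₄≡u : ∀ ℓ N m → - ((+ 1 + ℓ) + (+ 1 + N) + + 2 * m) ≡ - (ℓ + N + + 2 * (m + + 1))
  c₄≡u = solve-∀
  regroup : ∀ A u E c B w F → (A +L u *L E) +L c *L (B +L w *L F) ≋ (A +L c *L B) +L u *L E +L (c *L w) *L F
  regroup = RingSolver.solve-∀ Laurent-acr
  factor : ∀ X u E v F → X +L u *L E +L (u *L v) *L F ≋ X +L u *L (E +L v *L F)
  factor = RingSolver.solve-∀ Laurent-acr

identity₁ : ∀ ℓ m n → n ≤ ℓ → lhs₁ ℓ n m ≋ rhs₁ ℓ n m
identity₁ ℓ m zero z≤n = begin
  lhs₁ ℓ 0 m                  ≈⟨ lhs₁-0 ℓ m ⟩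
  [ + ℓ , + ℓ + m ]           ≈⟨ [,]-sym ℓ (+ ℓ + m) ⟩
  [ + ℓ , + ℓ - (+ ℓ + m) ]   ≈⟨ [,]-cong refl (ℓ-[ℓ+m]≡-m (+ ℓ) m) ⟩
  [ + ℓ , - m ]               ≈⟨ rhs₁-0 ℓ m ⟨
  rhs₁ ℓ 0 m                  ∎
  where
  ℓ-[ℓ+m]≡-m : ∀ ℓ m → ℓ - (ℓ + m) ≡ - m
  ℓ-[ℓ+m]≡-m = solve-∀
identity₁ (suc ℓ) m (suc n) (s≤s n≤ℓ) = begin
  lhs₁ (suc ℓ) (suc n) m
    ≈⟨ lhs₁-rec ℓ n m ⟩
  lhs₁ ℓ n (m + + 1) +L c *L lhs₁ (suc ℓ) n (m - + 1)
    ≈⟨ +L-cong (identity₁ ℓ (m + + 1) n n≤ℓ) (*L-congʳ c (identity₁ (suc ℓ) (m - + 1) n (ℕₚ.m≤n⇒m≤1+n n≤ℓ))) ⟩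
  rhs₁ ℓ n (m + + 1) +L c *L rhs₁ (suc ℓ) n (m - + 1)
    ≈⟨ rhs₁-contiguous ℓ m n n≤ℓ ⟩
  rhs₁ (suc ℓ) n m +L q^ (- (+ ℓ + + n + + 2 * m)) *L rhs₁ ℓ n (m - + 1)
    ≈⟨ rhs₁-rec ℓ n m ⟨
  rhs₁ (suc ℓ) (suc n) m
    ∎
  where c = q^ (- (+ ℓ + + 2 * m))

lhs₂-term : ℕ → ℕ → ℤ → ℕ → Laurent
lhs₂-term ℓ n m k =
  summand ((+ k - + n) * (+ 2 * + k + + ℓ + + 2 * m - + n + + 1)) (+ n) (+ k) (+ ℓ - + k) (+ k + + ℓ + m - + n)

rhs₂a-term : ℕ → ℕ → ℤ → ℕ → Laurent
rhs₂a-term ℓ n m k =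
  summand (+ k * (+ 2 * + k - + ℓ - + 2 * m - + n + + 1)) (+ n) (+ k) (+ ℓ - + k) (+ k - m)

rhs₂b-term : ℕ → ℕ → ℤ → ℕ → Laurent
rhs₂b-term ℓ n m k =
  summand (+ k * (+ 2 * + k - + ℓ - + 2 * m - + n - + 1)) (+ n) (+ k) (+ ℓ - + k - + 1) (+ k - m - + 1)

lhs₂ : ℕ → ℕ → ℤ → Laurent
lhs₂ ℓ n m = Σ< (suc n) (lhs₂-term ℓ n m)

rhs₂ : ℕ → ℕ → ℤ → Laurent
rhs₂ ℓ n m =
  q^ (- m - + n) *L Σ< (suc n) (rhs₂a-term ℓ n m)
    +L (constL (+ 1) +L constL (- + 1) *L q^ (+ ℓ - + n)) *L Σ< (suc n) (rhs₂b-term ℓ n m)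

module _ (L n : ℕ) (m : ℤ) {k : ℕ} (k≤L : k ≤ L) where

  private
    N = L ℕ.∸ k

    +N≡L-k : + N ≡ + L - + k
    +N≡L-k = sym ([+n]-[+i]≡+[n∸i] k≤L)

    1+L-k≡1+N : + suc L - + k ≡ + suc N
    1+L-k≡1+N = trans ([+n]-[+i]≡+[n∸i] (ℕₚ.m≤n⇒m≤1+n k≤L)) (cong +_ (ℕₚ.+-∸-assoc 1 k≤L))

  lhs₂-term-pascal : lhs₂-term (suc L) n m k ≋ q^ (- m - + n) *L lhs₁-term L n m k +L lhs₁-term L n (m + + 1) k
  lhs₂-term-pascal = begin
    lhs₂-term (suc L) n m k
      ≈⟨ summand-cong refl refl refl 1+L-k≡1+N refl ⟩
    summand e (+ n) (+ k) (+ suc N) K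
      ≈⟨ summand-pascal′ e (+ n) (+ k) N K ⟩
    summand (e + (+ suc N - K)) (+ n) (+ k) (+ N) (K - + 1) +L summand e (+ n) (+ k) (+ N) K
      ≈⟨ +L-cong (summand-cong exponent refl refl +N≡L-k (index₁ (+ k) (+ n) (+ L) m))
                 (summand-cong (exponent′ (+ k) (+ n) (+ L) m) refl refl +N≡L-k (index₂ (+ k) (+ n) (+ L) m)) ⟩
    summand (- m - + n + (+ k - + n) * (+ 2 * + k + + L + + 2 * m - + n)) (+ n) (+ k) (+ L - + k) (+ k + + L + m - + n)
      +L lhs₁-term L n (m + + 1) k
      ≈⟨ +L-congʳ (lhs₁-term L n (m + + 1) k) (summand-q^ (- m - + n) _ (+ n) (+ k) (+ L - + k) _) ⟨
    q^ (- m - + n) *L lhs₁-term L n m k +L lhs₁-term L n (m + + 1) k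
      ∎
    where
    e = (+ k - + n) * (+ 2 * + k + + suc L + + 2 * m - + n + + 1)
    K = + k + + suc L + m - + n
    exponent″ : ∀ k n L m → (k - n) * (+ 2 * k + (+ 1 + L) + + 2 * m - n + + 1) + ((+ 1 + (L - k)) - (k + (+ 1 + L) + m - n))
                            ≡ - m - n + (k - n) * (+ 2 * k + L + + 2 * m - n)
    exponent″ = solve-∀
    exponent : e + (+ suc N - K) ≡ - m - + n + (+ k - + n) * (+ 2 * + k + + L + + 2 * m - + n)
    exponent = trans (cong (λ x → e + ((+ 1 + x) - K)) +N≡L-k) (exponent″ (+ k) (+ n) (+ L) m)
    exponent′ : ∀ k n L m → (k - n) * (+ 2 * k + (+ 1 + L) + + 2 * m - n + + 1) ≡ (k - n) * (+ 2 * k + L + + 2 * (m + + 1) - n)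
    exponent′ = solve-∀
    index₁ : ∀ k n L m → k + (+ 1 + L) + m - n - + 1 ≡ k + L + m - n
    index₁ = solve-∀
    index₂ : ∀ k n L m → k + (+ 1 + L) + m - n ≡ k + L + (m + + 1) - n
    index₂ = solve-∀

  rhs₂a-term-pascal : q^ (- m - + n) *L rhs₂a-term (suc L) n m k ≋
                      q^ (- m - + n) *L rhs₁-term L n m k +L q^ (+ suc L - + n) *L rhs₁-term L n (m + + 1) k
  rhs₂a-term-pascal = begin
    c *L rhs₂a-term (suc L) n m k
      ≈⟨ *L-congʳ c (summand-cong refl refl refl 1+L-k≡1+N refl) ⟩
    c *L summand e (+ n) (+ k) (+ suc N) (+ k - m)
      ≈⟨ *L-congʳ c (summand-pascal′ e (+ n) (+ k) N (+ k - m)) ⟩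
    c *L (summand (e + (+ suc N - (+ k - m))) (+ n) (+ k) (+ N) (+ k - m - + 1) +L summand e (+ n) (+ k) (+ N) (+ k - m))
      ≈⟨ *L-distribˡ c _ _ ⟩
    c *L summand (e + (+ suc N - (+ k - m))) (+ n) (+ k) (+ N) (+ k - m - + 1) +L c *L summand e (+ n) (+ k) (+ N) (+ k - m)
      ≈⟨ +L-cong (summand-q^ (- m - + n) _ (+ n) (+ k) (+ N) _) (*L-congʳ c (summand-cong (exponent′ (+ k) (+ n) (+ L) m) refl refl +N≡L-k refl)) ⟩
    summand (- m - + n + (e + (+ suc N - (+ k - m)))) (+ n) (+ k) (+ N) (+ k - m - + 1) +L c *L rhs₁-term L n m k
      ≈⟨ +L-congʳ (c *L rhs₁-term L n m k) (summand-cong exponent refl refl +N≡L-k (index (+ k) m)) ⟩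
    summand (+ suc L - + n + + k * (+ 2 * + k - + L - + 2 * (m + + 1) - + n)) (+ n) (+ k) (+ L - + k) (+ k - (m + + 1))
      +L c *L rhs₁-term L n m k
      ≈⟨ +L-congʳ (c *L rhs₁-term L n m k) (summand-q^ (+ suc L - + n) _ (+ n) (+ k) (+ L - + k) _) ⟨
    q^ (+ suc L - + n) *L rhs₁-term L n (m + + 1) k +L c *L rhs₁-term L n m k
      ≈⟨ +L-comm _ _ ⟩
    c *L rhs₁-term L n m k +L q^ (+ suc L - + n) *L rhs₁-term L n (m + + 1) k
      ∎
    where
    c = q^ (- m - + n)
    e = + k * (+ 2 * + k - + suc L - + 2 * m - + n + + 1)
    exponent″ : ∀ k n L m → - m - n + (k * (+ 2 * k - (+ 1 + L) - + 2 * m - n + + 1) + ((+ 1 + (L - k)) - (k - m)))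
                            ≡ (+ 1 + L) - n + k * (+ 2 * k - L - + 2 * (m + + 1) - n)
    exponent″ = solve-∀
    exponent : - m - + n + (e + (+ suc N - (+ k - m))) ≡ + suc L - + n + + k * (+ 2 * + k - + L - + 2 * (m + + 1) - + n)
    exponent = trans (cong (λ x → - m - + n + (e + ((+ 1 + x) - (+ k - m)))) +N≡L-k) (exponent″ (+ k) (+ n) (+ L) m)
    exponent′ : ∀ k n L m → k * (+ 2 * k - (+ 1 + L) - + 2 * m - n + + 1) ≡ k * (+ 2 * k - L - + 2 * m - n)
    exponent′ = solve-∀
    index : ∀ k m → k - m - + 1 ≡ k - (m + + 1)
    index = solve-∀

rhs₂b-term-shift : ∀ L n m k → rhs₂b-term (suc L) n m k ≋ rhs₁-term L n (m + + 1) k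
rhs₂b-term-shift L n m k = begin
  rhs₂b-term (suc L) n m k
    ≈⟨ summand-cong (exponent (+ k) (+ n) (+ L) m) refl refl (index₁ (+ k) (+ L)) (index₂ (+ k) m) ⟩
  rhs₁-term L n (m + + 1) k
    ∎
  where
  exponent : ∀ k n L m → k * (+ 2 * k - (+ 1 + L) - + 2 * m - n - + 1) ≡ k * (+ 2 * k - L - + 2 * (m + + 1) - n)
  exponent = solve-∀
  index₁ : ∀ k L → (+ 1 + L) - k - + 1 ≡ L - k
  index₁ = solve-∀
  index₂ : ∀ k m → k - m - + 1 ≡ k - (m + + 1)
  index₂ = solve-∀

identity₂-< : ∀ ℓ m n → n < ℓ → lhs₂ ℓ n m ≋ rhs₂ ℓ n m
identity₂-< (suc L) m n (s≤s n≤L) = ≋-trans lhs≋ (≋-sym rhs≋)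
  where
  c = q^ (- m - + n)
  Q = q^ (+ suc L - + n)
  k≤L : ∀ {k} → k < suc n → k ≤ L
  k≤L (s≤s k≤n) = ℕₚ.≤-trans k≤n n≤L
  lhs≋ : lhs₂ (suc L) n m ≋ c *L rhs₁ L n m +L rhs₁ L n (m + + 1)
  lhs≋ = begin
    lhs₂ (suc L) n m
      ≈⟨ Σ<-cong (suc n) (λ k k<1+n → lhs₂-term-pascal L n m (k≤L k<1+n)) ⟩
    Σ< (suc n) (λ k → c *L lhs₁-term L n m k +L lhs₁-term L n (m + + 1) k)
      ≈⟨ Σ<-+ (suc n) (λ k → c *L lhs₁-term L n m k) (lhs₁-term L n (m + + 1)) ⟩
    Σ< (suc n) (λ k → c *L lhs₁-term L n m k) +L lhs₁ L n (m + + 1)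
      ≈⟨ +L-congʳ (lhs₁ L n (m + + 1)) (Σ<-*ˡ (suc n) c (lhs₁-term L n m)) ⟩
    c *L lhs₁ L n m +L lhs₁ L n (m + + 1)
      ≈⟨ +L-cong (*L-congʳ c (identity₁ L m n n≤L)) (identity₁ L (m + + 1) n n≤L) ⟩
    c *L rhs₁ L n m +L rhs₁ L n (m + + 1)
      ∎
  rhs≋ : rhs₂ (suc L) n m ≋ c *L rhs₁ L n m +L rhs₁ L n (m + + 1)
  rhs≋ = begin
    c *L Σ< (suc n) (rhs₂a-term (suc L) n m) +L (1L +L -L 1L *L Q) *L Σ< (suc n) (rhs₂b-term (suc L) n m)
      ≈⟨ +L-cong (Σ<-*ˡ (suc n) c (rhs₂a-term (suc L) n m))
                 (*L-congʳ (1L +L -L 1L *L Q) (≋-sym (Σ<-cong (suc n) (λ k _ → rhs₂b-term-shift L n m k)))) ⟨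
    Σ< (suc n) (λ k → c *L rhs₂a-term (suc L) n m k) +L (1L +L -L 1L *L Q) *L rhs₁ L n (m + + 1)
      ≈⟨ +L-congʳ ((1L +L -L 1L *L Q) *L rhs₁ L n (m + + 1)) (Σ<-cong (suc n) (λ k k<1+n → rhs₂a-term-pascal L n m (k≤L k<1+n))) ⟩
    Σ< (suc n) (λ k → c *L rhs₁-term L n m k +L Q *L rhs₁-term L n (m + + 1) k) +L (1L +L -L 1L *L Q) *L rhs₁ L n (m + + 1)
      ≈⟨ +L-congʳ ((1L +L -L 1L *L Q) *L rhs₁ L n (m + + 1))
                  (≋-trans (Σ<-+ (suc n) (λ k → c *L rhs₁-term L n m k) (λ k → Q *L rhs₁-term L n (m + + 1) k))
                           (+L-cong (Σ<-*ˡ (suc n) c (rhs₁-term L n m)) (Σ<-*ˡ (suc n) Q (rhs₁-term L n (m + + 1))))) ⟩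
    (c *L rhs₁ L n m +L Q *L rhs₁ L n (m + + 1)) +L (1L +L -L 1L *L Q) *L rhs₁ L n (m + + 1)
      ≈⟨ cancel c (rhs₁ L n m) Q (rhs₁ L n (m + + 1)) ⟩
    c *L rhs₁ L n m +L rhs₁ L n (m + + 1)
      ∎
    where
    cancel : ∀ c R Q R′ → (c *L R +L Q *L R′) +L (1L +L -L 1L *L Q) *L R′ ≋ c *L R +L R′
    cancel = RingSolver.solve-∀ Laurent-acr

module _ (n : ℕ) (m : ℤ) where

  private
    c = q^ (- m - + n)
    F = lhs₂-term n n m
    G : ℕ → Laurent
    G i = c *L rhs₂a-term n n m i
    E : ℕ → ℤ
    E k = (+ k - + n) * (+ 2 * + k + + n + + 2 * m - + n + + 1)
    E′ : ℕ → ℤ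
    E′ i = + i * (+ 2 * + i - + n - + 2 * m - + n + + 1)
    index : ∀ k n m → k + n + m - n ≡ k + m
    index = solve-∀

  lhs₂-term≋rhs₂a-term : ∀ {k i} → + i ≡ + k + m → k ≤ n → i ≤ n → F k ≋ G i
  lhs₂-term≋rhs₂a-term {k} {i} i≡k+m k≤n i≤n = begin
    F k
      ≈⟨ summand-cong refl refl refl ([+n]-[+i]≡+[n∸i] k≤n) (trans (index (+ k) (+ n) m) (sym i≡k+m)) ⟩
    summand (E k) (+ n) (+ k) (+ (n ℕ.∸ k)) (+ i)
      ≈⟨ summand-trinomial-sym (E k) n k i ⟩
    summand (E k) (+ n) (+ i) (+ (n ℕ.∸ i)) (+ k)
      ≈⟨ summand-cong exponent refl refl refl refl ⟩
    summand (- m - + n + E′ i) (+ n) (+ i) (+ (n ℕ.∸ i)) (+ k)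
      ≈⟨ summand-q^ (- m - + n) (E′ i) (+ n) (+ i) (+ (n ℕ.∸ i)) (+ k) ⟨
    c *L summand (E′ i) (+ n) (+ i) (+ (n ℕ.∸ i)) (+ k)
      ≈⟨ *L-congʳ c (summand-cong refl refl refl (sym ([+n]-[+i]≡+[n∸i] i≤n)) k≡i-m) ⟩
    G i
      ∎
    where
    exponent′ : ∀ k n m → (k - n) * (+ 2 * k + n + + 2 * m - n + + 1)
                          ≡ - m - n + (k + m) * (+ 2 * (k + m) - n - + 2 * m - n + + 1)
    exponent′ = solve-∀
    exponent : E k ≡ - m - + n + E′ i
    exponent = trans (exponent′ (+ k) (+ n) m) (cong (λ x → - m - + n + x * (+ 2 * x - + n - + 2 * m - + n + + 1)) (sym i≡k+m))
    k+m-m≡k : ∀ k m → k + m - m ≡ k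
    k+m-m≡k = solve-∀
    k≡i-m : + k ≡ + i - m
    k≡i-m = sym (trans (cong (_- m) i≡k+m) (k+m-m≡k (+ k) m))

  lhs₂-term-vanish-neg : ∀ {k j} → + k + m ≡ -[1+ j ] → F k ≋ 0L
  lhs₂-term-vanish-neg {k} {j} k+m<0 =
    summand-vanish₂ (E k) (+ n) (+ k) (≋-trans ([,]-cong refl (trans (index (+ k) (+ n) m) k+m<0)) ([,]-neg _ j))

  lhs₂-term-vanish-> : ∀ {k j} → k ≤ n → + k + m ≡ + j → n ℕ.∸ k < j → F k ≋ 0L
  lhs₂-term-vanish-> {k} {j} k≤n k+m≡j n-k<j =
    summand-vanish₂ (E k) (+ n) (+ k)
      (≋-trans ([,]-cong ([+n]-[+i]≡+[n∸i] k≤n) (trans (index (+ k) (+ n) m) k+m≡j)) ([,]-> n-k<j))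

  rhs₂a-term-vanish-neg : ∀ {i j} → + i - m ≡ -[1+ j ] → G i ≋ 0L
  rhs₂a-term-vanish-neg {i} {j} i-m<0 =
    *L-vanishʳ c (summand-vanish₂ (E′ i) (+ n) (+ i) (≋-trans ([,]-cong refl i-m<0) ([,]-neg _ j)))

  rhs₂a-term-vanish-> : ∀ {i j} → i ≤ n → + i - m ≡ + j → n ℕ.∸ i < j → G i ≋ 0L
  rhs₂a-term-vanish-> {i} {j} i≤n i-m≡j n-i<j =
    *L-vanishʳ c (summand-vanish₂ (E′ i) (+ n) (+ i) (≋-trans ([,]-cong ([+n]-[+i]≡+[n∸i] i≤n) i-m≡j) ([,]-> n-i<j)))

[+i]-[+d]≡-[1+d∸1+i] : ∀ {i d} → i < d → + i - + d ≡ -[1+ (d ℕ.∸ suc i) ]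
[+i]-[+d]≡-[1+d∸1+i] {i} {d} i<d =
  trans (ℤₚ.[+m]-[+n]≡m⊖n i d) (trans (ℤₚ.⊖-< i<d) (cong (λ x → - (+ x)) (ℕₚ.+-∸-assoc 1 i<d)))

lhs₂-diagonal : ∀ n m → lhs₂ n n m ≋ Σ< (suc n) (λ i → q^ (- m - + n) *L rhs₂a-term n n m i)
lhs₂-diagonal n (+ d) =
  Σ<-shift (suc n) d (lhs₂-term n n (+ d)) (λ i → q^ (- + d - + n) *L rhs₂a-term n n (+ d) i) matched lhs-vanishes rhs-vanishes
  where
  matched : ∀ k → k ℕ.+ d < suc n → lhs₂-term n n (+ d) k ≋ q^ (- + d - + n) *L rhs₂a-term n n (+ d) (d ℕ.+ k)
  matched k (s≤s k+d≤n) =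
    lhs₂-term≋rhs₂a-term n (+ d) (cong +_ (ℕₚ.+-comm d k))
      (ℕₚ.≤-trans (ℕₚ.m≤m+n k d) k+d≤n) (ℕₚ.≤-trans (ℕₚ.≤-reflexive (ℕₚ.+-comm d k)) k+d≤n)
  lhs-vanishes : ∀ k → k < suc n → suc n ≤ k ℕ.+ d → lhs₂-term n n (+ d) k ≋ 0L
  lhs-vanishes k (s≤s k≤n) n<k+d = lhs₂-term-vanish-> n (+ d) k≤n refl (ℕₚ.≤-<-trans (ℕₚ.m∸n≤m n k) n<k+d)
  rhs-vanishes : ∀ i → i < suc n → i < d → q^ (- + d - + n) *L rhs₂a-term n n (+ d) i ≋ 0L
  rhs-vanishes i _ i<d = rhs₂a-term-vanish-neg n (+ d) ([+i]-[+d]≡-[1+d∸1+i] i<d)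
lhs₂-diagonal n -[1+ d ] =
  ≋-sym (Σ<-shift (suc n) (suc d) (λ i → q^ (- m - + n) *L rhs₂a-term n n m i) (lhs₂-term n n m) matched rhs-vanishes lhs-vanishes)
  where
  m = -[1+ d ]
  matched : ∀ k → k ℕ.+ suc d < suc n → q^ (- m - + n) *L rhs₂a-term n n m k ≋ lhs₂-term n n m (suc d ℕ.+ k)
  matched k (s≤s k+1+d≤n) =
    ≋-sym (lhs₂-term≋rhs₂a-term n m (k≡1+d+k-1-d (+ d) (+ k))
             (ℕₚ.≤-trans (ℕₚ.≤-reflexive (ℕₚ.+-comm (suc d) k)) k+1+d≤n) (ℕₚ.≤-trans (ℕₚ.m≤m+n k (suc d)) k+1+d≤n))
    where
    k≡1+d+k-1-d : ∀ d k → k ≡ + 1 + d + k + - (+ 1 + d)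
    k≡1+d+k-1-d = solve-∀
  rhs-vanishes : ∀ k → k < suc n → suc n ≤ k ℕ.+ suc d → q^ (- m - + n) *L rhs₂a-term n n m k ≋ 0L
  rhs-vanishes k (s≤s k≤n) n<k+1+d = rhs₂a-term-vanish-> n m k≤n refl (ℕₚ.≤-<-trans (ℕₚ.m∸n≤m n k) n<k+1+d)
  lhs-vanishes : ∀ i → i < suc n → i < suc d → lhs₂-term n n m i ≋ 0L
  lhs-vanishes i _ i<1+d = lhs₂-term-vanish-neg n m ([+i]-[+d]≡-[1+d∸1+i] i<1+d)

rhs₂-unfold : ∀ ℓ n m → rhs₂ ℓ n m ≋ q^ (- m - + n) *L Σ< (suc n) (rhs₂a-term ℓ n m) +L (1L +L -L 1L *L q^ (+ ℓ - + n)) *L Σ< (suc n) (rhs₂b-term ℓ n m)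
rhs₂-unfold ℓ n m = ≋-refl

identity₂-diagonal : ∀ n m → lhs₂ n n m ≋ rhs₂ n n m
identity₂-diagonal n m = begin
  lhs₂ n n m                                    ≈⟨ lhs₂-diagonal n m ⟩
  Σ< (suc n) (λ i → c *L rhs₂a-term n n m i)    ≈⟨ Σ<-*ˡ (suc n) c (rhs₂a-term n n m) ⟩
  c *L S                                        ≈⟨ vanishing-correction (c *L S) T ⟩
  c *L S +L (1L +L -L 1L *L 1L) *L T            ≈⟨ +L-congˡ (c *L S) (*L-congˡ T (+L-congˡ 1L (*L-congʳ (-L 1L) q^[n-n]≋1))) ⟨
  c *L S +L (1L +L -L 1L *L q^ (+ n - + n)) *L T ≈⟨ rhs₂-unfold n n m ⟨
  rhs₂ n n m                                    ∎
  where
  c = q^ (- m - + n)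
  S = Σ< (suc n) (rhs₂a-term n n m)
  T = Σ< (suc n) (rhs₂b-term n n m)
  q^[n-n]≋1 : q^ (+ n - + n) ≋ 1L
  q^[n-n]≋1 = ≋-trans (q^-cong (ℤₚ.+-inverseʳ (+ n))) q^-0
  vanishing-correction : ∀ S T → S ≋ S +L (1L +L -L 1L *L 1L) *L T
  vanishing-correction = RingSolver.solve-∀ Laurent-acr

identity₂ : ∀ ℓ m n → n ≤ ℓ → lhs₂ ℓ n m ≋ rhs₂ ℓ n m
identity₂ ℓ m n n≤ℓ = by-cases (ℕₚ.m≤n⇒m<n∨m≡n n≤ℓ)
  where
  by-cases : n < ℓ ⊎ n ≡ ℓ → lhs₂ ℓ n m ≋ rhs₂ ℓ n m
  by-cases (inj₁ n<ℓ) = identity₂-< ℓ m n n<ℓ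
  by-cases (inj₂ n≡ℓ) = subst (λ ℓ → lhs₂ ℓ n m ≋ rhs₂ ℓ n m) n≡ℓ (identity₂-diagonal n m)

sumL≡Σ< : ∀ n f → sumL n f ≡ Σ< (suc n) f
sumL≡Σ< n f = foldr-applyUpTo id (suc n)
  where
  foldr-applyUpTo : ∀ g L → foldr (λ k acc → f k +L acc) 0L (applyUpTo g L) ≡ Σ< L (f ∘ g)
  foldr-applyUpTo g zero    = refl
  foldr-applyUpTo g (suc L) = cong (f (g 0) +L_) (foldr-applyUpTo (g ∘ suc) L)

sumL≋Σ< : ∀ n {f} g → (∀ k → g k ≡ f k) → sumL n f ≋ Σ< (suc n) g
sumL≋Σ< n {f} g g≡f = ≋-trans (≋-reflexive (sumL≡Σ< n f)) (Σ<-cong (suc n) (λ k _ → ≋-reflexive (sym (g≡f k))))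

corollary5p3 : (ℓ : ℕ) (m : ℤ) (n : ℕ) → n ≤ ℓ →
    (sumL n (λ k → qpow ((+ k - + n) * (+ 2 * + k + + ℓ + + 2 * m - + n))
                     *L qbin (+ n) (+ k)
                     *L qbin (+ ℓ - + k) (+ k + + ℓ + m - + n))
      ≈L
     sumL n (λ k → qpow (+ k * (+ 2 * + k - + ℓ - + 2 * m - + n))
                     *L qbin (+ n) (+ k)
                     *L qbin (+ ℓ - + k) (+ k - m)))
    ×
    (sumL n (λ k → qpow ((+ k - + n) * (+ 2 * + k + + ℓ + + 2 * m - + n + + 1))
                     *L qbin (+ n) (+ k)
                     *L qbin (+ ℓ - + k) (+ k + + ℓ + m - + n))
      ≈L
     (qpow (- m - + n)
        *L sumL n (λ k → qpow (+ k * (+ 2 * + k - + ℓ - + 2 * m - + n + + 1))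
                           *L qbin (+ n) (+ k)
                           *L qbin (+ ℓ - + k) (+ k - m))
      +L (constL (+ 1) +L constL (- + 1) *L qpow (+ ℓ - + n))
        *L sumL n (λ k → qpow (+ k * (+ 2 * + k - + ℓ - + 2 * m - + n - + 1))
                           *L qbin (+ n) (+ k)
                           *L qbin (+ ℓ - + k - + 1) (+ k - m - + 1))))
corollary5p3 ℓ m n n≤ℓ =
  ≋⇒≈L (≋-trans (sumL≋Σ< n (lhs₁-term ℓ n m) (λ k → summand≡qpow _ _ _ _ _))
                (≋-trans (identity₁ ℓ m n n≤ℓ) (≋-sym (sumL≋Σ< n (rhs₁-term ℓ n m) (λ k → summand≡qpow _ _ _ _ _))))) ,
  ≋⇒≈L (≋-trans (sumL≋Σ< n (lhs₂-term ℓ n m) (λ k → summand≡qpow _ _ _ _ _))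
                (≋-trans (identity₂ ℓ m n n≤ℓ)
                         (+L-cong (*L-cong (≋-reflexive (q^≡qpow (- m - + n)))
                                           (≋-sym (sumL≋Σ< n (rhs₂a-term ℓ n m) (λ k → summand≡qpow _ _ _ _ _))))
                                  (*L-cong (+L-congˡ 1L (*L-congʳ (-L 1L) (≋-reflexive (q^≡qpow (+ ℓ - + n)))))
                                           (≋-sym (sumL≋Σ< n (rhs₂b-term ℓ n m) (λ k → summand≡qpow _ _ _ _ _)))))))
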